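{- Let $G$ be a finite nilpotent group of order $n=p_1^{\alpha_1}\cdots p_r^{\alpha_r}$ with $p_1<\cdots<p_r$ primes, $\alpha_i\ge1$, $r\geq2$, and let $P_i$ be the Sylow $p_i$-subgroup of $G$. Let $x,y\in G$ with $\tau_x=\tau_y$. If $\langle x\rangle$ and $\langle y\rangle$ are maximal cyclic subgroups of $\prod_{i\in\tau_x}P_i$ of equal order, then $\deg(x)=\deg(y)$ in $\mathcal{P}(G)$.
   Context: The power graph $\mathcal{P}(G)$ has vertex set $G$, with two distinct vertices adjacent iff one is a positive power of the other; $\deg$ denotes degree in $\mathcal{P}(G)$. Since $G$ is the internal direct product $P_1P_2\cdots P_r$, every $x\in G$ can be written uniquely as $x=x_1x_2\cdots x_r$ with $x_i\in P_i$; set $\tau_x=\{j\in[r]:x_j\neq e\}$, where $e$ is the identity and $[r]=\{1,\dots,r\}$. For $I\subseteq[r]$, $\prod_{i\in I}P_i$ denotes the subgroup (internal direct product) generated by the $P_i$, $i\in I$. A cyclic subgroup of a group $H$ is maximal cyclic if it is not properly contained in any cyclic subgroup of $H$. -}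

module Defs where

open import Level using (0ℓ)
open import Data.Nat using (ℕ; zero; suc; _≤_; _<_; _^_)
import Data.Nat
open import Data.Fin using (Fin)
import Data.Fin as Fin
open import Data.Fin.Subset using (Subset; _∈_; _∉_)
open import Data.Product using (Σ; ∃; _×_; _,_)
open import Data.Sum using (_⊎_)
open import Data.Unit using (⊤)
open import Relation.Binary.PropositionalEquality using (_≡_; _≢_)
open import Relation.Nullary using (¬_)
open import Function using (_∘_)
open import Algebra.Structures using (IsGroup)

record Grp : Set₁ where
  infixl 7 _∙_
  field
    Carrier : Set
    _∙_     : Carrier → Carrier → Carrier
    e       : Carrier
    _⁻¹     : Carrier → Carrier
    isGroup : IsGroup _≡_ _∙_ e _⁻¹

module GroupNotions (G : Grp) where
  open Grp G public

  Pred : Set₁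
  Pred = Carrier → Set

  pow : Carrier → ℕ → Carrier
  pow x zero    = e
  pow x (suc k) = x ∙ pow x k

  data ⟨_⟩ (S : Pred) : Pred where
    gen : ∀ {z} → S z → ⟨ S ⟩ z
    one : ⟨ S ⟩ e
    mul : ∀ {a b} → ⟨ S ⟩ a → ⟨ S ⟩ b → ⟨ S ⟩ (a ∙ b)
    inv : ∀ {a} → ⟨ S ⟩ a → ⟨ S ⟩ (a ⁻¹)

  cyc : Carrier → Pred
  cyc x = ⟨ (λ z → z ≡ x) ⟩

  _⊆_ : Pred → Pred → Set
  S ⊆ T = ∀ {z} → S z → T z

  IsSubgroup : Pred → Set
  IsSubgroup H = H e × (∀ {a b} → H a → H b → H (a ∙ b)) × (∀ {a} → H a → H (a ⁻¹))

  Card : Pred → ℕ → Set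
  Card S m = Σ (Fin m → Carrier) λ f → Σ (Carrier → Fin m) λ g →
               (∀ i → S (f i)) × (∀ z → S z → f (g z) ≡ z) × (∀ i → g (f i) ≡ i)

  [_,_] : Carrier → Carrier → Carrier
  [ a , b ] = (a ⁻¹) ∙ (b ⁻¹) ∙ a ∙ b

  γ : ℕ → Pred
  γ zero    = λ _ → ⊤
  γ (suc k) = ⟨ (λ z → ∃ λ a → ∃ λ b → γ k a × z ≡ [ a , b ]) ⟩

  Nilpotent : Set
  Nilpotent = ∃ λ c → ∀ z → γ c z → z ≡ e

  PosPow : Carrier → Carrier → Set
  PosPow x z = ∃ λ k → z ≡ pow x (suc k)

  -- neighbourhood of x in the power graph
  Nbr : Carrier → Pred
  Nbr x z = z ≢ x × (PosPow x z ⊎ PosPow z x)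

  Deg : Carrier → ℕ → Set
  Deg x d = Card (Nbr x) d

  MaxCyclicIn : Carrier → Pred → Set
  MaxCyclicIn x H = H x × (∀ z → H z → cyc x ⊆ cyc z → cyc z ⊆ cyc x)

  prod : ∀ {r} → (Fin r → Carrier) → Carrier
  prod {zero}  c = e
  prod {suc r} c = c Fin.zero ∙ prod (c ∘ Fin.suc)

  -- τ_x = T, w.r.t. a family P of subgroups: x = x_1⋯x_r with x_i ∈ P_i and
  -- T = { j | x_j ≠ e }
  Support : ∀ {r} → (Fin r → Pred) → Carrier → Subset r → Set
  Support {r} P x T = Σ (Fin r → Carrier) λ c →
    (∀ i → P i (c i)) × (x ≡ prod c) × (∀ j → (j ∈ T → c j ≢ e) × (j ∉ T → c j ≡ e))

  ProdSub : ∀ {r} → (Fin r → Pred) → Subset r → Pred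
  ProdSub P T = ⟨ (λ z → ∃ λ i → i ∈ T × P i z) ⟩

prodℕ : ∀ {r} → (Fin r → ℕ) → ℕ
prodℕ {zero}  f = 1
prodℕ {suc r} f = f Fin.zero Data.Nat.* prodℕ (f ∘ Fin.suc)

module Submission where

-- In a nilpotent group elements of coprime orders commute.  Hence, with M = ∏_{i ∈ T} |P_i| and
-- M' = n / M, every z ∈ G splits uniquely as z = w ∙ t with w ^ M = e and t ^ M' = e, and the
-- elements w with w ^ M = e form H = ∏_{i ∈ T} P_i.  Let x ∈ H have order o, with ⟨x⟩ maximal
-- cyclic in H.  A positive power of x has t = e; conversely x is a power of z = w ∙ t iff it is
-- the same power of w, which by maximality means w = x ^ k with gcd (k , o) = 1, t arbitrary.
-- So the neighbours of x are the x ^ k ∙ t with (k , t) ranging over a set that depends on o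
-- alone, and deg x is determined by |⟨x⟩|.

open import Defs
open import Data.Nat using (ℕ; zero; suc; _+_; _*_; _^_; _≤_; _<_; s≤s)
open import Data.Fin using (Fin; toℕ) renaming (zero to fzero; suc to fsuc)
open import Data.Fin.Subset using (Subset)
open import Data.Nat.Primality using (Prime)
open import Data.Product using (Σ; ∃; ∃₂; _×_; _,_; proj₁; proj₂)
open import Data.Sum using (_⊎_; inj₁; inj₂)
open import Data.Unit using (⊤; tt)
open import Data.Empty using (⊥-elim)
open import Function using (_∘_)
open import Relation.Binary.PropositionalEquality hiding ([_])
open import Relation.Nullary using (¬_; Dec; yes; no)

module LeastWitness where

  open import Relation.Unary using (Decidable)
  open import Data.Nat.Induction using (<-rec)
  open import Data.Nat.Properties using (anyUpTo?)

  least : {P : ℕ → Set} → Decidable P → ∀ b → P b → ∃ λ m → P m × (∀ {j} → j < m → ¬ P j)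
  least {P} P? = <-rec (λ b → P b → ∃ λ m → P m × (∀ {j} → j < m → ¬ P j)) search
    where
    search : ∀ b → (∀ {j} → j < b → P j → ∃ λ m → P m × (∀ {i} → i < m → ¬ P i)) →
             P b → ∃ λ m → P m × (∀ {j} → j < m → ¬ P j)
    search b smaller pb with anyUpTo? P? b
    ... | yes (j , j<b , pj) = smaller j<b pj
    ... | no none            = b , pb , λ j<b pj → none (_ , j<b , pj)

module UniqueLists where

  open import Function.Bundles using (mk⇔)
  open import Relation.Binary.Definitions using (DecidableEquality)
  open import Relation.Unary using (Decidable)
  open import Relation.Unary.Properties using (∁?)
  open import Data.List using (List; []; _∷_; length; filter; map)
  open import Data.List.Properties using (length-filter)
  open import Data.List.Membership.Propositional using (_∈_)
  open import Data.List.Membership.Propositional.Properties using (∈-filter⁺; ∈-filter⁻; ∈-map⁻)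
  open import Data.List.Membership.DecPropositional using () renaming (_∈?_ to ∈?-with)
  open import Data.List.Membership.Propositional.Properties.WithK using (unique∧set⇒bag)
  open import Data.List.Relation.Binary.Subset.Propositional using (_⊆_)
  open import Data.List.Relation.Binary.BagAndSetEquality using (∼bag⇒↭)
  open import Data.List.Relation.Binary.Permutation.Propositional.Properties using (↭-length)
  open import Data.List.Relation.Unary.Unique.Propositional using (Unique)
  open import Data.List.Relation.Unary.Unique.Propositional.Properties using (filter⁺)
  open import Data.List.Relation.Unary.AllPairs using ([]; _∷_)
  import Data.List.Relation.Unary.All as All
  open import Data.List.Relation.Unary.Any using (here; there)
  open import Data.Nat.Properties using (≤-trans; ≤-reflexive; <-irrefl; +-suc)

  module _ {A : Set} where

    ⊆∧⊇⇒length≡ : {xs ys : List A} → Unique xs → Unique ys → xs ⊆ ys → ys ⊆ xs → length xs ≡ length ys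
    ⊆∧⊇⇒length≡ xs! ys! xs⊆ys ys⊆xs = ↭-length (∼bag⇒↭ (unique∧set⇒bag xs! ys! (mk⇔ xs⊆ys ys⊆xs)))

    length-filter-∁ : {P : A → Set} (P? : Decidable P) (xs : List A) →
                      length xs ≡ length (filter P? xs) + length (filter (∁? P?) xs)
    length-filter-∁ P? []       = refl
    length-filter-∁ P? (x ∷ xs) with P? x
    ... | yes _ = cong suc (length-filter-∁ P? xs)
    ... | no  _ = trans (cong suc (length-filter-∁ P? xs)) (sym (+-suc _ _))

    map⁺-injectiveOn : {B : Set} (f : A → B) {xs : List A} →
                       (∀ {a b} → a ∈ xs → b ∈ xs → f a ≡ f b → a ≡ b) → Unique xs → Unique (map f xs)
    map⁺-injectiveOn f {[]}     inj []         = []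
    map⁺-injectiveOn f {a ∷ xs} inj (a∉ ∷ xs!) =
      All.tabulate (λ z∈ fa≡z → let (b , b∈ , z≡fb) = ∈-map⁻ f z∈ in
                      All.lookup a∉ b∈ (inj (here refl) (there b∈) (trans fa≡z z≡fb)))
      ∷ map⁺-injectiveOn f (λ a∈ b∈ → inj (there a∈) (there b∈)) xs!

  module _ {A : Set} (_≟_ : DecidableEquality A) where

    private
      _∈?_ : (z : A) (xs : List A) → Dec (z ∈ xs)
      _∈?_ = ∈?-with _≟_

    ⊆⇒length≤ : {xs ys : List A} → Unique xs → Unique ys → xs ⊆ ys → length xs ≤ length ys
    ⊆⇒length≤ {xs} {ys} xs! ys! xs⊆ys = ≤-trans (≤-reflexive xs≡ys∩xs) (length-filter (_∈? xs) ys)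
      where
      xs≡ys∩xs : length xs ≡ length (filter (_∈? xs) ys)
      xs≡ys∩xs = ⊆∧⊇⇒length≡ xs! (filter⁺ (_∈? xs) ys!)
        (λ z∈xs → ∈-filter⁺ (_∈? xs) (xs⊆ys z∈xs) z∈xs)
        (λ z∈ → proj₂ (∈-filter⁻ (_∈? xs) {xs = ys} z∈))

    ⊆∧length≥⇒⊇ : {xs ys : List A} → Unique xs → Unique ys → xs ⊆ ys → length ys ≤ length xs → ys ⊆ xs
    ⊆∧length≥⇒⊇ {xs} {ys} xs! ys! xs⊆ys ys≤xs {z} z∈ys with z ∈? xs
    ... | yes z∈xs = z∈xs
    ... | no  z∉xs = ⊥-elim (<-irrefl refl (≤-trans (⊆⇒length≤ z∷xs! ys! z∷xs⊆ys) ys≤xs))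
      where
      z∷xs! : Unique (z ∷ xs)
      z∷xs! = All.tabulate (λ w∈ z≡w → z∉xs (subst (_∈ xs) (sym z≡w) w∈)) ∷ xs!
      z∷xs⊆ys : (z ∷ xs) ⊆ ys
      z∷xs⊆ys (here refl) = z∈ys
      z∷xs⊆ys (there w∈)  = xs⊆ys w∈

module Arithmetic where

  open import Data.Nat using (_%_; _/_; NonZero)
  open import Data.Nat.Properties using (+-comm; ^-monoʳ-<)
  open import Data.Nat.DivMod using (m≡m%n+[m/n]*n)
  open import Data.Nat.Divisibility using (_∣_; ∣-trans; m∣m*n; ∣n⇒∣m*n; ∣m⇒∣m*n; ∣m+n∣m⇒∣n; ∣1⇒≡1)
  open import Data.Nat.Coprimality using (Coprime; coprime-divisor; 1-coprimeTo)
  import Data.Nat.Coprimality as Coprime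
  open import Data.Nat.Primality using (Prime; prime⇒irreducible; prime⇒nonTrivial)
  open import Data.Nat.Base using (nonTrivial⇒≢1; nonTrivial⇒n>1)

  coprime-∣ˡ : ∀ {a b d} → Coprime a b → d ∣ a → Coprime d b
  coprime-∣ˡ a⊥b d∣a (i∣d , i∣b) = a⊥b (∣-trans i∣d d∣a , i∣b)

  coprime-*ʳ : ∀ {a b c} → Coprime a b → Coprime a c → Coprime a (b * c)
  coprime-*ʳ a⊥b a⊥c (d∣a , d∣bc) = a⊥c (d∣a , coprime-divisor (coprime-∣ˡ a⊥b d∣a) d∣bc)

  coprime-1ʳ : ∀ a → Coprime a 1
  coprime-1ʳ a = Coprime.sym (1-coprimeTo a)

  coprime-^ʳ : ∀ {a b} → Coprime a b → ∀ k → Coprime a (b ^ k)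
  coprime-^ʳ {a} a⊥b zero    = coprime-1ʳ a
  coprime-^ʳ     a⊥b (suc k) = coprime-*ʳ a⊥b (coprime-^ʳ a⊥b k)

  coprime-prodℕʳ : ∀ {a r} (f : Fin r → ℕ) → (∀ i → Coprime a (f i)) → Coprime a (prodℕ f)
  coprime-prodℕʳ {a} {zero}  f a⊥f = coprime-1ʳ a
  coprime-prodℕʳ {r = suc r} f a⊥f = coprime-*ʳ (a⊥f fzero) (coprime-prodℕʳ (f ∘ fsuc) (a⊥f ∘ fsuc))

  distinct-primes-coprime : ∀ {p q} → Prime p → Prime q → p ≢ q → Coprime p q
  distinct-primes-coprime p-prime q-prime p≢q (d∣p , d∣q) with prime⇒irreducible p-prime d∣p
  ... | inj₁ d≡1 = d≡1
  ... | inj₂ refl with prime⇒irreducible q-prime d∣q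
  ...   | inj₁ p≡1 = ⊥-elim (nonTrivial⇒≢1 {{prime⇒nonTrivial p-prime}} p≡1)
  ...   | inj₂ p≡q = ⊥-elim (p≢q p≡q)

  distinct-prime-powers-coprime : ∀ {p q} → Prime p → Prime q → p ≢ q → ∀ a b → Coprime (p ^ a) (q ^ b)
  distinct-prime-powers-coprime p-prime q-prime p≢q a b =
    Coprime.sym (coprime-^ʳ (Coprime.sym (coprime-^ʳ (distinct-primes-coprime p-prime q-prime p≢q) b)) a)

  ∣m∧∣n⇒∣m%n : ∀ {d} m n .{{_ : NonZero n}} → d ∣ m → d ∣ n → d ∣ m % n
  ∣m∧∣n⇒∣m%n m n d∣m d∣n =
    ∣m+n∣m⇒∣n (subst (_ ∣_) (trans (m≡m%n+[m/n]*n m n) (+-comm (m % n) _)) d∣m) (∣n⇒∣m*n (m / n) d∣n)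

  *≡1-mod⇒coprime : ∀ k s o .{{_ : NonZero o}} → (k * s) % o ≡ 1 % o → Coprime k o
  *≡1-mod⇒coprime k s (suc zero)    _      (_ , d∣1) = ∣1⇒≡1 d∣1
  *≡1-mod⇒coprime k s (suc (suc o)) ks≡1 {d} (d∣k , d∣o) =
    ∣1⇒≡1 (subst (d ∣_) ks≡1 (∣m∧∣n⇒∣m%n (k * s) (suc (suc o)) (∣m⇒∣m*n s d∣k) d∣o))

  prime-power≥2 : ∀ {p a} → Prime p → 0 < a → 2 ≤ p ^ a
  prime-power≥2 {p} p-prime 0<a = ^-monoʳ-< p (nonTrivial⇒n>1 p {{prime⇒nonTrivial p-prime}}) 0<a

  ∣-prodℕ : ∀ {r} (f : Fin r → ℕ) i → f i ∣ prodℕ f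
  ∣-prodℕ f fzero    = m∣m*n _
  ∣-prodℕ f (fsuc i) = ∣n⇒∣m*n (f fzero) (∣-prodℕ (f ∘ fsuc) i)

  prodℕ-cong : ∀ {r} {f g : Fin r → ℕ} → (∀ i → f i ≡ g i) → prodℕ f ≡ prodℕ g
  prodℕ-cong {zero}  f≗g = refl
  prodℕ-cong {suc r} f≗g = cong₂ _*_ (f≗g fzero) (prodℕ-cong (f≗g ∘ fsuc))

  prodℕ-* : ∀ {r} (f g : Fin r → ℕ) → prodℕ (λ i → f i * g i) ≡ prodℕ f * prodℕ g
  prodℕ-* {zero}  f g = refl
  prodℕ-* {suc r} f g =
    trans (cong (f fzero * g fzero *_) (prodℕ-* (f ∘ fsuc) (g ∘ fsuc)))
          (interchange (f fzero) (g fzero) (prodℕ (f ∘ fsuc)) (prodℕ (g ∘ fsuc)))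
    where
    open import Data.Nat.Tactic.RingSolver using (solve-∀)
    interchange : ∀ a b c d → a * b * (c * d) ≡ a * c * (b * d)
    interchange = solve-∀

module MixedRadix where

  open import Data.Fin using (remQuot; combine)
  open import Data.Fin.Properties using (combine-remQuot)
  open import Data.Product using (uncurry)

  digits : ∀ {r} (base : Fin r → ℕ) → Fin (prodℕ base) → (i : Fin r) → Fin (base i)
  digits {suc r} base a fzero    = proj₁ (remQuot {base fzero} (prodℕ (base ∘ fsuc)) a)
  digits {suc r} base a (fsuc i) = digits (base ∘ fsuc) (proj₂ (remQuot {base fzero} (prodℕ (base ∘ fsuc)) a)) i

  digits-injective : ∀ {r} (base : Fin r → ℕ) {a b} → (∀ i → digits base a i ≡ digits base b i) → a ≡ b
  digits-injective {zero}  base {fzero} {fzero} _ = refl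
  digits-injective {suc r} base {a} {b} same =
    trans (sym (combine-remQuot {base fzero} k a))
      (trans (cong (uncurry combine) (cong₂ _,_ (same fzero) (digits-injective (base ∘ fsuc) (same ∘ fsuc))))
             (combine-remQuot {base fzero} k b))
    where
    k : ℕ
    k = prodℕ (base ∘ fsuc)

module GroupLaws (G : Grp) where

  open import Level using (0ℓ)
  open import Algebra.Bundles using (Group)
  open import Algebra.Structures using (IsGroup)
  open import Data.Nat.Properties using (*-comm; +-suc; m≤n⇒∃[o]m+o≡n)

  open GroupNotions G public
  open IsGroup isGroup public using (assoc; identityˡ; identityʳ; inverseˡ; inverseʳ)

  group : Group 0ℓ 0ℓ
  group = record { isGroup = isGroup }

  open import Algebra.Properties.Group group public
    using (∙-cancelˡ; ∙-cancelʳ; inverseˡ-unique; inverseʳ-unique; ⁻¹-involutive; ⁻¹-anti-homo-∙; ε⁻¹≈ε)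

  open ≡-Reasoning

  ∙-cancel-middle : ∀ a g b → a ∙ g ∙ (g ⁻¹ ∙ b) ≡ a ∙ b
  ∙-cancel-middle a g b = begin
    a ∙ g ∙ (g ⁻¹ ∙ b)   ≡⟨ assoc a g (g ⁻¹ ∙ b) ⟩
    a ∙ (g ∙ (g ⁻¹ ∙ b)) ≡⟨ cong (a ∙_) (sym (assoc g (g ⁻¹) b)) ⟩
    a ∙ (g ∙ g ⁻¹ ∙ b)   ≡⟨ cong (λ z → a ∙ (z ∙ b)) (inverseʳ g) ⟩
    a ∙ (e ∙ b)          ≡⟨ cong (a ∙_) (identityˡ b) ⟩
    a ∙ b                ∎

  Commute : Carrier → Carrier → Set
  Commute a b = a ∙ b ≡ b ∙ a

  commute-e : ∀ a → Commute a e
  commute-e a = trans (identityʳ a) (sym (identityˡ a))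

  commute-∙ : ∀ {a b c} → Commute a b → Commute a c → Commute a (b ∙ c)
  commute-∙ {a} {b} {c} ab ac = begin
    a ∙ (b ∙ c) ≡⟨ sym (assoc a b c) ⟩
    a ∙ b ∙ c   ≡⟨ cong (_∙ c) ab ⟩
    b ∙ a ∙ c   ≡⟨ assoc b a c ⟩
    b ∙ (a ∙ c) ≡⟨ cong (b ∙_) ac ⟩
    b ∙ (c ∙ a) ≡⟨ sym (assoc b c a) ⟩
    b ∙ c ∙ a   ∎

  commute-⁻¹ : ∀ {a b} → Commute a b → Commute (a ⁻¹) b
  commute-⁻¹ {a} {b} ab = begin
    a ⁻¹ ∙ b              ≡⟨ sym (identityʳ (a ⁻¹ ∙ b)) ⟩
    a ⁻¹ ∙ b ∙ e          ≡⟨ cong (a ⁻¹ ∙ b ∙_) (sym (inverseʳ a)) ⟩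
    a ⁻¹ ∙ b ∙ (a ∙ a ⁻¹) ≡⟨ sym (assoc (a ⁻¹ ∙ b) a (a ⁻¹)) ⟩
    a ⁻¹ ∙ b ∙ a ∙ a ⁻¹   ≡⟨ cong (_∙ a ⁻¹) (assoc (a ⁻¹) b a) ⟩
    a ⁻¹ ∙ (b ∙ a) ∙ a ⁻¹ ≡⟨ cong (λ z → a ⁻¹ ∙ z ∙ a ⁻¹) (sym ab) ⟩
    a ⁻¹ ∙ (a ∙ b) ∙ a ⁻¹ ≡⟨ cong (_∙ a ⁻¹) (sym (assoc (a ⁻¹) a b)) ⟩
    a ⁻¹ ∙ a ∙ b ∙ a ⁻¹   ≡⟨ cong (λ z → z ∙ b ∙ a ⁻¹) (inverseˡ a) ⟩
    e ∙ b ∙ a ⁻¹          ≡⟨ cong (_∙ a ⁻¹) (identityˡ b) ⟩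
    b ∙ a ⁻¹              ∎

  commute-pow : ∀ {a b} → Commute a b → ∀ k → Commute a (pow b k)
  commute-pow {a} ab zero    = commute-e a
  commute-pow     ab (suc k) = commute-∙ ab (commute-pow ab k)

  pow-1 : ∀ x → pow x 1 ≡ x
  pow-1 = identityʳ

  pow-suc-∙ʳ : ∀ x k → pow x (suc k) ≡ pow x k ∙ x
  pow-suc-∙ʳ x = commute-pow refl

  pow-+ : ∀ x m n → pow x (m + n) ≡ pow x m ∙ pow x n
  pow-+ x zero    n = sym (identityˡ (pow x n))
  pow-+ x (suc m) n = trans (cong (x ∙_) (pow-+ x m n)) (sym (assoc x (pow x m) (pow x n)))

  pow-* : ∀ x m n → pow x (m * n) ≡ pow (pow x m) n
  pow-* x m zero    = cong (pow x) (*-comm m 0)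
  pow-* x m (suc n) = begin
    pow x (m * suc n)          ≡⟨ cong (pow x) (trans (*-comm m (suc n)) (cong (m +_) (*-comm n m))) ⟩
    pow x (m + m * n)          ≡⟨ pow-+ x m (m * n) ⟩
    pow x m ∙ pow x (m * n)    ≡⟨ cong (pow x m ∙_) (pow-* x m n) ⟩
    pow x m ∙ pow (pow x m) n  ∎

  pow-*-comm : ∀ x m n → pow x (m * n) ≡ pow (pow x n) m
  pow-*-comm x m n = trans (cong (pow x) (*-comm m n)) (pow-* x n m)

  pow-e : ∀ k → pow e k ≡ e
  pow-e zero    = refl
  pow-e (suc k) = trans (identityˡ (pow e k)) (pow-e k)

  pow-⁻¹ : ∀ x k → pow (x ⁻¹) k ≡ pow x k ⁻¹
  pow-⁻¹ x zero    = sym ε⁻¹≈ε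
  pow-⁻¹ x (suc k) = begin
    x ⁻¹ ∙ pow (x ⁻¹) k  ≡⟨ cong (x ⁻¹ ∙_) (pow-⁻¹ x k) ⟩
    x ⁻¹ ∙ pow x k ⁻¹    ≡⟨ sym (⁻¹-anti-homo-∙ (pow x k) x) ⟩
    (pow x k ∙ x) ⁻¹     ≡⟨ cong _⁻¹ (sym (pow-suc-∙ʳ x k)) ⟩
    pow x (suc k) ⁻¹     ∎

  pow-∙ : ∀ {a b} → Commute a b → ∀ k → pow (a ∙ b) k ≡ pow a k ∙ pow b k
  pow-∙ ab zero = sym (identityˡ e)
  pow-∙ {a} {b} ab (suc k) = begin
    a ∙ b ∙ pow (a ∙ b) k        ≡⟨ cong (a ∙ b ∙_) (pow-∙ ab k) ⟩
    a ∙ b ∙ (pow a k ∙ pow b k)  ≡⟨ assoc a b (pow a k ∙ pow b k) ⟩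
    a ∙ (b ∙ (pow a k ∙ pow b k)) ≡⟨ cong (a ∙_) (sym (assoc b (pow a k) (pow b k))) ⟩
    a ∙ (b ∙ pow a k ∙ pow b k)  ≡⟨ cong (λ z → a ∙ (z ∙ pow b k)) (commute-pow (sym ab) k) ⟩
    a ∙ (pow a k ∙ b ∙ pow b k)  ≡⟨ cong (a ∙_) (assoc (pow a k) b (pow b k)) ⟩
    a ∙ (pow a k ∙ (b ∙ pow b k)) ≡⟨ sym (assoc a (pow a k) (b ∙ pow b k)) ⟩
    a ∙ pow a k ∙ (b ∙ pow b k)  ∎

  pow-*≡e : ∀ {x a} → pow x a ≡ e → ∀ m → pow x (m * a) ≡ e
  pow-*≡e {x} {a} xᵃ≡e m = trans (pow-*-comm x m a) (trans (cong (λ z → pow z m) xᵃ≡e) (pow-e m))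

  pow-pow≡e : ∀ {x a} → pow x a ≡ e → ∀ j → pow (pow x j) a ≡ e
  pow-pow≡e {x} {a} xᵃ≡e j = trans (sym (pow-* x j a)) (pow-*≡e xᵃ≡e j)

  card-injective : ∀ {S m} (c : Card S m) {i j} → proj₁ c i ≡ proj₁ c j → i ≡ j
  card-injective (_ , g , _ , _ , g∘f≗id) {i} {j} fi≡fj = trans (sym (g∘f≗id i)) (trans (cong g fi≡fj) (g∘f≗id j))

  pow∈cyc : ∀ x k → cyc x (pow x k)
  pow∈cyc x zero    = one
  pow∈cyc x (suc k) = mul (gen refl) (pow∈cyc x k)

  cyc-⊆ : ∀ {w x} → cyc w x → cyc x ⊆ cyc w
  cyc-⊆ x∈⟨w⟩ (gen refl) = x∈⟨w⟩
  cyc-⊆ x∈⟨w⟩ one        = one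
  cyc-⊆ x∈⟨w⟩ (mul p q)  = mul (cyc-⊆ x∈⟨w⟩ p) (cyc-⊆ x∈⟨w⟩ q)
  cyc-⊆ x∈⟨w⟩ (inv p)    = inv (cyc-⊆ x∈⟨w⟩ p)

  pow-repeat⇒pow≡e : ∀ x {i j} → i < j → pow x i ≡ pow x j → ∃ λ d → suc (i + d) ≡ j × pow x (suc d) ≡ e
  pow-repeat⇒pow≡e x {i} i<j xⁱ≡xʲ with m≤n⇒∃[o]m+o≡n i<j
  ... | d , refl = d , refl , ∙-cancelˡ (pow x i) _ _ (begin
    pow x i ∙ pow x (suc d) ≡⟨ sym (pow-+ x i (suc d)) ⟩
    pow x (i + suc d)       ≡⟨ cong (pow x) (+-suc i d) ⟩
    pow x (suc (i + d))     ≡⟨ sym xⁱ≡xʲ ⟩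
    pow x i                 ≡⟨ sym (identityʳ (pow x i)) ⟩
    pow x i ∙ e             ∎)

module CoprimeExponents (G : Grp) where

  open GroupLaws G
  open import Data.Nat.Coprimality using (Coprime; coprime-Bézout)
  import Data.Nat.Coprimality as Coprime
  open import Data.Nat.Divisibility using (∣-refl; _∣0)
  open import Data.Nat.GCD using (module Bézout)
  open ≡-Reasoning

  coprime⇒pow-invertible : ∀ {A B} → Coprime A B → ∃ λ J → ∀ g → pow g B ≡ e → pow (pow g A) J ≡ g
  coprime⇒pow-invertible {A} {B} A⊥B with coprime-Bézout A⊥B
  ... | Bézout.+- u v 1+vB≡uA = u , λ g gᴮ≡e → begin
    pow (pow g A) u      ≡⟨ sym (pow-*-comm g u A) ⟩
    pow g (u * A)        ≡⟨ cong (pow g) (sym 1+vB≡uA) ⟩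
    pow g (1 + v * B)    ≡⟨ pow-+ g 1 (v * B) ⟩
    pow g 1 ∙ pow g (v * B) ≡⟨ cong₂ _∙_ (pow-1 g) (pow-*≡e gᴮ≡e v) ⟩
    g ∙ e                ≡⟨ identityʳ g ⟩
    g                    ∎
  ... | Bézout.-+ u v 1+uA≡vB = inverse-case B A⊥B 1+uA≡vB
    where
    inverse-case : ∀ B → Coprime A B → 1 + u * A ≡ v * B → ∃ λ J → ∀ g → pow g B ≡ e → pow (pow g A) J ≡ g
    inverse-case zero A⊥0 _ = 1 , λ g _ → trans (pow-1 (pow g A)) (trans (cong (pow g) (A⊥0 (∣-refl , (A ∣0)))) (pow-1 g))
    inverse-case (suc B') _ 1+uA≡vB = u * B' , λ g gᴮ≡e →
      let gᴮ'≡g⁻¹ : pow g B' ≡ g ⁻¹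
          gᴮ'≡g⁻¹ = inverseˡ-unique (pow g B') g (trans (sym (pow-suc-∙ʳ g B')) gᴮ≡e)
          gᴬᵘ≡g⁻¹ : pow (pow g A) u ≡ g ⁻¹
          gᴬᵘ≡g⁻¹ = inverseʳ-unique g (pow (pow g A) u) (begin
            g ∙ pow (pow g A) u     ≡⟨ cong₂ _∙_ (sym (pow-1 g)) (sym (pow-*-comm g u A)) ⟩
            pow g 1 ∙ pow g (u * A) ≡⟨ sym (pow-+ g 1 (u * A)) ⟩
            pow g (1 + u * A)       ≡⟨ cong (pow g) 1+uA≡vB ⟩
            pow g (v * suc B')      ≡⟨ pow-*≡e gᴮ≡e v ⟩
            e                       ∎)
      in begin
      pow (pow g A) (u * B')      ≡⟨ pow-* (pow g A) u B' ⟩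
      pow (pow (pow g A) u) B'    ≡⟨ cong (λ z → pow z B') gᴬᵘ≡g⁻¹ ⟩
      pow (g ⁻¹) B'               ≡⟨ pow-⁻¹ g B' ⟩
      pow g B' ⁻¹                 ≡⟨ cong _⁻¹ gᴮ'≡g⁻¹ ⟩
      g ⁻¹ ⁻¹                     ≡⟨ ⁻¹-involutive g ⟩
      g                           ∎

  pow-injective-coprime : ∀ {A B c c'} → Coprime A B → pow c A ≡ e → pow c' A ≡ e → pow c B ≡ pow c' B → c ≡ c'
  pow-injective-coprime {A} {B} {c} {c'} A⊥B cᴬ≡e c'ᴬ≡e cᴮ≡c'ᴮ with coprime⇒pow-invertible (Coprime.sym A⊥B)
  ... | J , invert = begin
    c                ≡⟨ sym (invert c cᴬ≡e) ⟩
    pow (pow c B) J  ≡⟨ cong (λ z → pow z J) cᴮ≡c'ᴮ ⟩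
    pow (pow c' B) J ≡⟨ invert c' c'ᴬ≡e ⟩
    c'               ∎

module GroupProducts (G : Grp) where

  open GroupLaws G
  open import Data.Fin.Properties using (suc-injective)

  commute-prod : ∀ {r} a (c : Fin r → Carrier) → (∀ i → Commute a (c i)) → Commute a (prod c)
  commute-prod {zero}  a c _      = commute-e a
  commute-prod {suc r} a c a↔c = commute-∙ (a↔c fzero) (commute-prod a (c ∘ fsuc) (a↔c ∘ fsuc))

  prod-e : ∀ {r} (c : Fin r → Carrier) → (∀ i → c i ≡ e) → prod c ≡ e
  prod-e {zero}  c _    = refl
  prod-e {suc r} c c≗e = trans (cong₂ _∙_ (c≗e fzero) (prod-e (c ∘ fsuc) (c≗e ∘ fsuc))) (identityˡ e)

  pow-prod : ∀ {r} (c : Fin r → Carrier) → (∀ i j → i ≢ j → Commute (c i) (c j)) →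
             ∀ k → pow (prod c) k ≡ prod (λ i → pow (c i) k)
  pow-prod {zero}  c _ k = pow-e k
  pow-prod {suc r} c c↔c k =
    trans (pow-∙ (commute-prod (c fzero) (c ∘ fsuc) (λ i → c↔c fzero (fsuc i) λ ())) k)
          (cong (pow (c fzero) k ∙_) (pow-prod (c ∘ fsuc) (λ i j i≢j → c↔c (fsuc i) (fsuc j) (i≢j ∘ suc-injective)) k))

  prod∈⟨⟩ : ∀ {r} (S : Pred) (c : Fin r → Carrier) → (∀ i → c i ≡ e ⊎ S (c i)) → ⟨ S ⟩ (prod c)
  prod∈⟨⟩ {zero}  S c _      = one
  prod∈⟨⟩ {suc r} S c c∈S₀ = mul (component (c∈S₀ fzero)) (prod∈⟨⟩ S (c ∘ fsuc) (c∈S₀ ∘ fsuc))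
    where
    component : c fzero ≡ e ⊎ S (c fzero) → ⟨ S ⟩ (c fzero)
    component (inj₁ c₀≡e) = subst ⟨ S ⟩ (sym c₀≡e) one
    component (inj₂ c₀∈S) = gen c₀∈S

module NilpotentGroups (G : Grp) where

  open GroupLaws G
  open import Data.Nat.Coprimality using (Coprime; coprime-Bézout)
  import Data.Nat.Coprimality as Coprime
  open import Data.Nat.GCD using (module Bézout)
  open ≡-Reasoning

  conj : Carrier → Carrier → Carrier
  conj g a = g ⁻¹ ∙ a ∙ g

  conj-∙ : ∀ g a b → conj g (a ∙ b) ≡ conj g a ∙ conj g b
  conj-∙ g a b = sym (begin
    g ⁻¹ ∙ a ∙ g ∙ (g ⁻¹ ∙ b ∙ g)   ≡⟨ cong (g ⁻¹ ∙ a ∙ g ∙_) (assoc (g ⁻¹) b g) ⟩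
    g ⁻¹ ∙ a ∙ g ∙ (g ⁻¹ ∙ (b ∙ g)) ≡⟨ ∙-cancel-middle (g ⁻¹ ∙ a) g (b ∙ g) ⟩
    g ⁻¹ ∙ a ∙ (b ∙ g)              ≡⟨ sym (assoc (g ⁻¹ ∙ a) b g) ⟩
    g ⁻¹ ∙ a ∙ b ∙ g                ≡⟨ cong (_∙ g) (assoc (g ⁻¹) a b) ⟩
    g ⁻¹ ∙ (a ∙ b) ∙ g              ∎)

  conj-e : ∀ g → conj g e ≡ e
  conj-e g = trans (cong (_∙ g) (identityʳ (g ⁻¹))) (inverseˡ g)

  conj-⁻¹ : ∀ g a → conj g (a ⁻¹) ≡ conj g a ⁻¹
  conj-⁻¹ g a = inverseʳ-unique (conj g a) (conj g (a ⁻¹))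
    (trans (sym (conj-∙ g a (a ⁻¹))) (trans (cong (conj g) (inverseʳ a)) (conj-e g)))

  conj-[,] : ∀ g a b → conj g [ a , b ] ≡ [ conj g a , conj g b ]
  conj-[,] g a b = begin
    conj g (a ⁻¹ ∙ b ⁻¹ ∙ a ∙ b)
      ≡⟨ conj-∙ g (a ⁻¹ ∙ b ⁻¹ ∙ a) b ⟩
    conj g (a ⁻¹ ∙ b ⁻¹ ∙ a) ∙ conj g b
      ≡⟨ cong (_∙ conj g b) (conj-∙ g (a ⁻¹ ∙ b ⁻¹) a) ⟩
    conj g (a ⁻¹ ∙ b ⁻¹) ∙ conj g a ∙ conj g b
      ≡⟨ cong (λ z → z ∙ conj g a ∙ conj g b) (conj-∙ g (a ⁻¹) (b ⁻¹)) ⟩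
    conj g (a ⁻¹) ∙ conj g (b ⁻¹) ∙ conj g a ∙ conj g b
      ≡⟨ cong₂ (λ u v → u ∙ v ∙ conj g a ∙ conj g b) (conj-⁻¹ g a) (conj-⁻¹ g b) ⟩
    [ conj g a , conj g b ] ∎

  [,]-swap : ∀ x y → [ y , x ] ≡ [ x , y ] ⁻¹
  [,]-swap x y = sym (begin
    (x ⁻¹ ∙ y ⁻¹ ∙ x ∙ y) ⁻¹                ≡⟨ ⁻¹-anti-homo-∙ (x ⁻¹ ∙ y ⁻¹ ∙ x) y ⟩
    y ⁻¹ ∙ (x ⁻¹ ∙ y ⁻¹ ∙ x) ⁻¹             ≡⟨ cong (y ⁻¹ ∙_) (⁻¹-anti-homo-∙ (x ⁻¹ ∙ y ⁻¹) x) ⟩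
    y ⁻¹ ∙ (x ⁻¹ ∙ (x ⁻¹ ∙ y ⁻¹) ⁻¹)        ≡⟨ cong (λ z → y ⁻¹ ∙ (x ⁻¹ ∙ z)) (⁻¹-anti-homo-∙ (x ⁻¹) (y ⁻¹)) ⟩
    y ⁻¹ ∙ (x ⁻¹ ∙ (y ⁻¹ ⁻¹ ∙ x ⁻¹ ⁻¹))    ≡⟨ cong₂ (λ u v → y ⁻¹ ∙ (x ⁻¹ ∙ (u ∙ v))) (⁻¹-involutive y) (⁻¹-involutive x) ⟩
    y ⁻¹ ∙ (x ⁻¹ ∙ (y ∙ x))                 ≡⟨ sym (assoc (y ⁻¹) (x ⁻¹) (y ∙ x)) ⟩
    y ⁻¹ ∙ x ⁻¹ ∙ (y ∙ x)                   ≡⟨ sym (assoc (y ⁻¹ ∙ x ⁻¹) y x) ⟩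
    y ⁻¹ ∙ x ⁻¹ ∙ y ∙ x                     ∎)

  [,e]≡e : ∀ x → [ x , e ] ≡ e
  [,e]≡e x = begin
    x ⁻¹ ∙ e ⁻¹ ∙ x ∙ e ≡⟨ identityʳ (x ⁻¹ ∙ e ⁻¹ ∙ x) ⟩
    x ⁻¹ ∙ e ⁻¹ ∙ x     ≡⟨ cong (λ z → x ⁻¹ ∙ z ∙ x) ε⁻¹≈ε ⟩
    x ⁻¹ ∙ e ∙ x        ≡⟨ cong (_∙ x) (identityʳ (x ⁻¹)) ⟩
    x ⁻¹ ∙ x            ≡⟨ inverseˡ x ⟩
    e                   ∎

  [,∙]-expand : ∀ x y w → [ x , y ∙ w ] ≡ [ x , w ] ∙ conj w [ x , y ]
  [,∙]-expand x y w = sym (begin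
    x ⁻¹ ∙ w ⁻¹ ∙ x ∙ w ∙ (w ⁻¹ ∙ (x ⁻¹ ∙ y ⁻¹ ∙ x ∙ y) ∙ w)
      ≡⟨ cong (x ⁻¹ ∙ w ⁻¹ ∙ x ∙ w ∙_) (assoc (w ⁻¹) _ w) ⟩
    x ⁻¹ ∙ w ⁻¹ ∙ x ∙ w ∙ (w ⁻¹ ∙ (x ⁻¹ ∙ y ⁻¹ ∙ x ∙ y ∙ w))
      ≡⟨ ∙-cancel-middle (x ⁻¹ ∙ w ⁻¹ ∙ x) w _ ⟩
    x ⁻¹ ∙ w ⁻¹ ∙ x ∙ (x ⁻¹ ∙ y ⁻¹ ∙ x ∙ y ∙ w)
      ≡⟨ cong (x ⁻¹ ∙ w ⁻¹ ∙ x ∙_) (trans (assoc _ y w) (trans (assoc _ x _) (assoc (x ⁻¹) _ _))) ⟩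
    x ⁻¹ ∙ w ⁻¹ ∙ x ∙ (x ⁻¹ ∙ (y ⁻¹ ∙ (x ∙ (y ∙ w))))
      ≡⟨ ∙-cancel-middle (x ⁻¹ ∙ w ⁻¹) x _ ⟩
    x ⁻¹ ∙ w ⁻¹ ∙ (y ⁻¹ ∙ (x ∙ (y ∙ w)))
      ≡⟨ sym (assoc (x ⁻¹ ∙ w ⁻¹) (y ⁻¹) _) ⟩
    x ⁻¹ ∙ w ⁻¹ ∙ y ⁻¹ ∙ (x ∙ (y ∙ w))
      ≡⟨ cong (_∙ (x ∙ (y ∙ w))) (trans (assoc (x ⁻¹) (w ⁻¹) (y ⁻¹)) (cong (x ⁻¹ ∙_) (sym (⁻¹-anti-homo-∙ y w)))) ⟩
    x ⁻¹ ∙ (y ∙ w) ⁻¹ ∙ (x ∙ (y ∙ w))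
      ≡⟨ sym (assoc (x ⁻¹ ∙ (y ∙ w) ⁻¹) x (y ∙ w)) ⟩
    x ⁻¹ ∙ (y ∙ w) ⁻¹ ∙ x ∙ (y ∙ w) ∎)

  γ-e : ∀ k → γ k e
  γ-e zero    = tt
  γ-e (suc k) = one

  γ-∙ : ∀ k {a b} → γ k a → γ k b → γ k (a ∙ b)
  γ-∙ zero    _ _ = tt
  γ-∙ (suc k) p q = mul p q

  γ-⁻¹ : ∀ k {a} → γ k a → γ k (a ⁻¹)
  γ-⁻¹ zero    _ = tt
  γ-⁻¹ (suc k) p = inv p

  γ-pow : ∀ k {a} → γ k a → ∀ j → γ k (pow a j)
  γ-pow k p zero    = γ-e k
  γ-pow k p (suc j) = γ-∙ k p (γ-pow k p j)

  γ-conj : ∀ k g {a} → γ k a → γ k (conj g a)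
  γ-conj zero    g _ = tt
  γ-conj (suc k) g (gen (a , b , a∈γₖ , refl)) = gen (conj g a , conj g b , γ-conj k g a∈γₖ , conj-[,] g a b)
  γ-conj (suc k) g one       = subst (γ (suc k)) (sym (conj-e g)) one
  γ-conj (suc k) g (mul p q) = subst (γ (suc k)) (sym (conj-∙ g _ _)) (mul (γ-conj (suc k) g p) (γ-conj (suc k) g q))
  γ-conj (suc k) g (inv p)   = subst (γ (suc k)) (sym (conj-⁻¹ g _)) (inv (γ-conj (suc k) g p))

  γ-from-Bézout : ∀ k {c} u v a b → 1 + v * b ≡ u * a → γ k (pow c a) → γ k (pow c b) → γ k c
  γ-from-Bézout k {c} u v a b 1+vb≡ua cᵃ∈γ cᵇ∈γ =
    subst (γ k) cᵘᵃ∙c⁻ᵛᵇ≡c (γ-∙ k (subst (γ k) (sym (pow-*-comm c u a)) (γ-pow k cᵃ∈γ u))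
                                  (γ-⁻¹ k (subst (γ k) (sym (pow-*-comm c v b)) (γ-pow k cᵇ∈γ v))))
    where
    cᵘᵃ∙c⁻ᵛᵇ≡c : pow c (u * a) ∙ pow c (v * b) ⁻¹ ≡ c
    cᵘᵃ∙c⁻ᵛᵇ≡c = begin
      pow c (u * a) ∙ pow c (v * b) ⁻¹             ≡⟨ cong (λ z → pow c z ∙ pow c (v * b) ⁻¹) (sym 1+vb≡ua) ⟩
      pow c (1 + v * b) ∙ pow c (v * b) ⁻¹         ≡⟨ cong (_∙ pow c (v * b) ⁻¹) (pow-+ c 1 (v * b)) ⟩
      pow c 1 ∙ pow c (v * b) ∙ pow c (v * b) ⁻¹   ≡⟨ assoc (pow c 1) _ _ ⟩
      pow c 1 ∙ (pow c (v * b) ∙ pow c (v * b) ⁻¹) ≡⟨ cong (pow c 1 ∙_) (inverseʳ _) ⟩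
      pow c 1 ∙ e                                  ≡⟨ identityʳ (pow c 1) ⟩
      pow c 1                                      ≡⟨ pow-1 c ⟩
      c                                            ∎

  γ-coprime-powers : ∀ k {c a b} → Coprime a b → γ k (pow c a) → γ k (pow c b) → γ k c
  γ-coprime-powers k {a = a} {b} a⊥b cᵃ∈γ cᵇ∈γ with coprime-Bézout a⊥b
  ... | Bézout.+- u v 1+vb≡ua = γ-from-Bézout k u v a b 1+vb≡ua cᵃ∈γ cᵇ∈γ
  ... | Bézout.-+ u v 1+ua≡vb = γ-from-Bézout k v u b a 1+ua≡vb cᵇ∈γ cᵃ∈γ

  -- Modulo γ (suc k) the elements of γ k are central, so j ↦ [ x , y ^ j ] is a homomorphism
  -- as long as its values lie in γ k.
  module ModuloNext (k : ℕ) where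

    infix 4 _≈_
    _≈_ : Carrier → Carrier → Set
    a ≈ b = γ (suc k) (a ⁻¹ ∙ b)

    ≈-reflexive : ∀ {a b} → a ≡ b → a ≈ b
    ≈-reflexive {a} refl = subst (γ (suc k)) (sym (inverseˡ a)) one

    ≈-sym : ∀ {a b} → a ≈ b → b ≈ a
    ≈-sym {a} {b} a≈b = subst (γ (suc k)) (trans (⁻¹-anti-homo-∙ (a ⁻¹) b) (cong (b ⁻¹ ∙_) (⁻¹-involutive a))) (inv a≈b)

    ≈-∙ : ∀ {a b c d} → a ≈ b → c ≈ d → a ∙ c ≈ b ∙ d
    ≈-∙ {a} {b} {c} {d} a≈b c≈d = subst (γ (suc k)) regroup (mul (γ-conj (suc k) c a≈b) c≈d)
      where
      regroup : conj c (a ⁻¹ ∙ b) ∙ (c ⁻¹ ∙ d) ≡ (a ∙ c) ⁻¹ ∙ (b ∙ d)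
      regroup = begin
        c ⁻¹ ∙ (a ⁻¹ ∙ b) ∙ c ∙ (c ⁻¹ ∙ d) ≡⟨ ∙-cancel-middle (c ⁻¹ ∙ (a ⁻¹ ∙ b)) c d ⟩
        c ⁻¹ ∙ (a ⁻¹ ∙ b) ∙ d              ≡⟨ cong (_∙ d) (sym (assoc (c ⁻¹) (a ⁻¹) b)) ⟩
        c ⁻¹ ∙ a ⁻¹ ∙ b ∙ d                ≡⟨ cong (λ z → z ∙ b ∙ d) (sym (⁻¹-anti-homo-∙ a c)) ⟩
        (a ∙ c) ⁻¹ ∙ b ∙ d                 ≡⟨ assoc ((a ∙ c) ⁻¹) b d ⟩
        (a ∙ c) ⁻¹ ∙ (b ∙ d)               ∎

    conj-≈ : ∀ {c} w → γ k c → conj w c ≈ c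
    conj-≈ {c} w c∈γₖ = ≈-sym (gen (c , w , c∈γₖ , c⁻¹∙conj≡[c,w]))
      where
      c⁻¹∙conj≡[c,w] : c ⁻¹ ∙ (w ⁻¹ ∙ c ∙ w) ≡ [ c , w ]
      c⁻¹∙conj≡[c,w] = trans (cong (c ⁻¹ ∙_) (assoc (w ⁻¹) c w))
                         (trans (sym (assoc (c ⁻¹) (w ⁻¹) (c ∙ w))) (sym (assoc (c ⁻¹ ∙ w ⁻¹) c w)))

    [,pow]≈pow[,] : ∀ x y → (∀ j → γ k [ x , pow y j ]) → ∀ j → [ x , pow y j ] ≈ pow [ x , y ] j
    [,pow]≈pow[,] x y [x,yʲ]∈γₖ zero    = ≈-reflexive ([,e]≡e x)
    [,pow]≈pow[,] x y [x,yʲ]∈γₖ (suc j) =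
      subst₂ _≈_ (sym ([,∙]-expand x y (pow y j))) (sym (pow-suc-∙ʳ [ x , y ] j))
        (≈-∙ ([,pow]≈pow[,] x y [x,yʲ]∈γₖ j)
             (conj-≈ (pow y j) (subst (γ k) (cong [ x ,_] (pow-1 y)) ([x,yʲ]∈γₖ 1))))

    pow[,]∈γ : ∀ x y b → pow y b ≡ e → (∀ j → γ k [ x , pow y j ]) → γ (suc k) (pow [ x , y ] b)
    pow[,]∈γ x y b yᵇ≡e [x,yʲ]∈γₖ =
      subst (γ (suc k)) (trans (cong (_∙ pow [ x , y ] b) ε⁻¹≈ε) (identityˡ _))
        (subst (_≈ pow [ x , y ] b) (trans (cong [ x ,_] yᵇ≡e) ([,e]≡e x)) ([,pow]≈pow[,] x y [x,yʲ]∈γₖ b))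

  coprime-orders-[,]∈γ : ∀ k x y {a b} → Coprime a b → pow x a ≡ e → pow y b ≡ e → γ k [ x , y ]
  coprime-orders-[,]∈γ zero    x y a⊥b xᵃ≡e yᵇ≡e = tt
  coprime-orders-[,]∈γ (suc k) x y {a} {b} a⊥b xᵃ≡e yᵇ≡e = γ-coprime-powers (suc k) a⊥b [x,y]ᵃ∈γ [x,y]ᵇ∈γ
    where
    [x,y]ᵇ∈γ : γ (suc k) (pow [ x , y ] b)
    [x,y]ᵇ∈γ = ModuloNext.pow[,]∈γ k x y b yᵇ≡e
      (λ j → coprime-orders-[,]∈γ k x (pow y j) a⊥b xᵃ≡e (pow-pow≡e {y} {b} yᵇ≡e j))
    [y,x]ᵃ∈γ : γ (suc k) (pow [ y , x ] a)
    [y,x]ᵃ∈γ = ModuloNext.pow[,]∈γ k y x a xᵃ≡e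
      (λ j → coprime-orders-[,]∈γ k y (pow x j) (Coprime.sym a⊥b) yᵇ≡e (pow-pow≡e {x} {a} xᵃ≡e j))
    [x,y]ᵃ∈γ : γ (suc k) (pow [ x , y ] a)
    [x,y]ᵃ∈γ = subst (γ (suc k))
      (trans (cong _⁻¹ (trans (cong (λ z → pow z a) ([,]-swap x y)) (pow-⁻¹ [ x , y ] a))) (⁻¹-involutive _))
      (inv [y,x]ᵃ∈γ)

  coprime-orders-commute : Nilpotent → ∀ {x y a b} → Coprime a b → pow x a ≡ e → pow y b ≡ e → Commute x y
  coprime-orders-commute (c , γ-trivial) {x} {y} a⊥b xᵃ≡e yᵇ≡e = begin
    x ∙ y                   ≡⟨ inverseʳ-unique (x ⁻¹ ∙ y ⁻¹) (x ∙ y) (trans (sym (assoc _ x y)) [x,y]≡e) ⟩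
    (x ⁻¹ ∙ y ⁻¹) ⁻¹        ≡⟨ ⁻¹-anti-homo-∙ (x ⁻¹) (y ⁻¹) ⟩
    y ⁻¹ ⁻¹ ∙ x ⁻¹ ⁻¹       ≡⟨ cong₂ _∙_ (⁻¹-involutive y) (⁻¹-involutive x) ⟩
    y ∙ x                   ∎
    where
    [x,y]≡e : [ x , y ] ≡ e
    [x,y]≡e = γ-trivial _ (coprime-orders-[,]∈γ c x y a⊥b xᵃ≡e yᵇ≡e)

module FiniteGroup (G : Grp) (n : ℕ) (card : GroupNotions.Card G (λ _ → ⊤) n) where

  open GroupLaws G
  open LeastWitness
  open UniqueLists
  open import Data.Nat using (_%_; _/_; pred)
  open import Data.Nat.Properties using (≤-refl; ≤-trans; ≤-pred; <⇒≤; n<1+n; m≤n+m; +-suc; <-cmp)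
  open import Data.Nat.DivMod using (m≡m%n+[m/n]*n; m%n<n)
  open import Data.Nat.Divisibility using (_∣_; divides; m%n≡0⇒n∣m; ∣m∣n⇒∣m+n; ∣-reflexive)
  import Data.Fin as Fin
  open import Data.Fin.Properties using (pigeonhole)
  open import Data.List using (List; []; _∷_; length; tabulate; lookup; applyUpTo; filter)
  open import Data.List.Properties using (length-tabulate; length-applyUpTo)
  open import Data.List.Membership.Propositional using (_∈_)
  open import Data.List.Membership.Propositional.Properties
    using (∈-tabulate⁺; ∈-tabulate⁻; ∈-lookup; ∈-applyUpTo⁺; ∈-applyUpTo⁻; ∈-filter⁺; ∈-filter⁻)
  open import Data.List.Membership.DecPropositional using () renaming (_∈?_ to ∈?-with)
  open import Data.List.Relation.Unary.Unique.Propositional using (Unique)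
  open import Data.List.Relation.Unary.Unique.Propositional.Properties using (tabulate⁺; applyUpTo⁺₁; filter⁺)
  open import Data.List.Relation.Unary.AllPairs using (_∷_)
  import Data.List.Relation.Unary.All as All
  open import Data.List.Relation.Unary.Any using (here; there; index)
  open import Data.List.Relation.Unary.Any.Properties using (lookup-index)
  open import Relation.Binary.Definitions using (DecidableEquality; tri<; tri≈; tri>)
  open import Relation.Unary.Properties using (∁?)
  open ≡-Reasoning

  private
    enum : Fin n → Carrier
    enum = proj₁ card
    index-of : Carrier → Fin n
    index-of = proj₁ (proj₂ card)
    enum-index-of : ∀ z → enum (index-of z) ≡ z
    enum-index-of z = proj₁ (proj₂ (proj₂ (proj₂ card))) z tt

  _≟_ : DecidableEquality Carrier
  z ≟ w with index-of z Fin.≟ index-of w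
  ... | yes eq = yes (trans (sym (enum-index-of z)) (trans (cong enum eq) (enum-index-of w)))
  ... | no  ne = no (ne ∘ cong index-of)

  private
    _∈?_ : (z : Carrier) (L : List Carrier) → Dec (z ∈ L)
    _∈?_ = ∈?-with _≟_

  card≥2⇒nontrivial : ∀ {S m} → Card S m → 2 ≤ m → ∃ λ z → z ≢ e
  card≥2⇒nontrivial {m = suc (suc m)} c (s≤s (s≤s _)) with proj₁ c fzero ≟ e
  ... | no  f₀≢e = proj₁ c fzero , f₀≢e
  ... | yes f₀≡e = proj₁ c (fsuc fzero) , λ f₁≡e → 0≢1 (card-injective c (trans f₀≡e (sym f₁≡e)))
    where
    0≢1 : fzero {suc m} ≢ fsuc fzero
    0≢1 ()

  IsListing : Pred → List Carrier → Set
  IsListing S L = Unique L × (∀ {z} → S z → z ∈ L) × (∀ {z} → z ∈ L → S z)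

  card⇒listing : ∀ {S m} → Card S m → Σ (List Carrier) λ L → IsListing S L × length L ≡ m
  card⇒listing {S} c@(f , g , f∈S , f∘g≗id , _) =
    tabulate f ,
    (tabulate⁺ (card-injective c) ,
     (λ {z} z∈S → subst (_∈ tabulate f) (f∘g≗id z z∈S) (∈-tabulate⁺ (g z))) ,
     (λ z∈ → let (i , z≡fi) = ∈-tabulate⁻ z∈ in subst S (sym z≡fi) (f∈S i))) ,
    length-tabulate f

  card≡length : ∀ {S m L} → Card S m → IsListing S L → m ≡ length L
  card≡length c (L! , S⊆L , L⊆S) with card⇒listing c
  ... | L' , (L'! , S⊆L' , L'⊆S) , length≡m =
    trans (sym length≡m) (⊆∧⊇⇒length≡ L'! L! (S⊆L ∘ L'⊆S) (S⊆L' ∘ L⊆S))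

  private
    index-∈-lookup : ∀ {L : List Carrier} → Unique L → ∀ i (p : lookup L i ∈ L) → index p ≡ i
    index-∈-lookup {a ∷ L} _          fzero    (here _)  = refl
    index-∈-lookup {a ∷ L} (a∉ ∷ L!)  fzero    (there p) = ⊥-elim (All.lookup a∉ p refl)
    index-∈-lookup {a ∷ L} (a∉ ∷ L!)  (fsuc i) (here px) = ⊥-elim (All.lookup a∉ (subst (_∈ L) px (∈-lookup i)) refl)
    index-∈-lookup {a ∷ L} (a∉ ∷ L!)  (fsuc i) (there p) = cong fsuc (index-∈-lookup L! i p)

  -- Inhabitation is needed to give the inverse bijection a value off the subset.
  listing⇒card : ∀ {S L} → IsListing S L → ∃ S → Card S (length L)
  listing⇒card {S} {L} (L! , S⊆L , L⊆S) (z₀ , z₀∈S) =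
    lookup L , position , L⊆S ∘ ∈-lookup , lookup-position , position-lookup
    where
    position : Carrier → Fin (length L)
    position z with z ∈? L
    ... | yes z∈L = index z∈L
    ... | no  _   = index (S⊆L z₀∈S)
    lookup-position : ∀ z → S z → lookup L (position z) ≡ z
    lookup-position z z∈S with z ∈? L
    ... | yes z∈L = sym (lookup-index z∈L)
    ... | no  z∉L = ⊥-elim (z∉L (S⊆L z∈S))
    position-lookup : ∀ i → position (lookup L i) ≡ i
    position-lookup i with lookup L i ∈? L
    ... | yes p = index-∈-lookup L! i p
    ... | no  ¬p = ⊥-elim (¬p (∈-lookup i))

  private abstract
    finite-exponent : ∀ x → ∃ λ d → pow x (suc d) ≡ e
    finite-exponent x with pigeonhole (n<1+n n) (λ k → index-of (pow x (Fin.toℕ k)))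
    ... | i , j , i<j , same-index with pow-repeat⇒pow≡e x i<j
                                          (trans (sym (enum-index-of _)) (trans (cong enum same-index) (enum-index-of _)))
    ... | d , _ , xᵈ⁺¹≡e = d , xᵈ⁺¹≡e

    order-witness : ∀ x → ∃ λ o → pow x (suc o) ≡ e × (∀ {j} → j < o → pow x (suc j) ≢ e)
    order-witness x = least (λ k → pow x (suc k) ≟ e) (proj₁ (finite-exponent x)) (proj₂ (finite-exponent x))

  ord : Carrier → ℕ
  ord x = suc (proj₁ (order-witness x))

  pow-ord : ∀ x → pow x (ord x) ≡ e
  pow-ord x = proj₁ (proj₂ (order-witness x))

  pow-pred-ord : ∀ x → x ⁻¹ ≡ pow x (pred (ord x))
  pow-pred-ord x = sym (inverseˡ-unique (pow x (pred (ord x))) x (trans (sym (pow-suc-∙ʳ x (pred (ord x)))) (pow-ord x)))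

  ord-minimal : ∀ x {d} → suc d < ord x → pow x (suc d) ≢ e
  ord-minimal x d<o = proj₂ (proj₂ (order-witness x)) (≤-pred d<o)

  pow-distinct-below-ord : ∀ x {i j} → i < j → j < ord x → pow x i ≢ pow x j
  pow-distinct-below-ord x {i} i<j j<o xⁱ≡xʲ with pow-repeat⇒pow≡e x i<j xⁱ≡xʲ
  ... | d , refl , xᵈ⁺¹≡e = ord-minimal x (≤-trans (s≤s (s≤s (m≤n+m d i))) j<o) xᵈ⁺¹≡e

  pow-injective-below-ord : ∀ x {i j} → i < ord x → j < ord x → pow x i ≡ pow x j → i ≡ j
  pow-injective-below-ord x {i} {j} i<o j<o xⁱ≡xʲ with <-cmp i j
  ... | tri< i<j _ _ = ⊥-elim (pow-distinct-below-ord x i<j j<o xⁱ≡xʲ)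
  ... | tri≈ _ i≡j _ = i≡j
  ... | tri> _ _ j<i = ⊥-elim (pow-distinct-below-ord x j<i i<o (sym xⁱ≡xʲ))

  pow-*ord : ∀ x q → pow x (q * ord x) ≡ e
  pow-*ord x = pow-*≡e (pow-ord x)

  pow-%ord : ∀ x a → pow x a ≡ pow x (a % ord x)
  pow-%ord x a = begin
    pow x a                                        ≡⟨ cong (pow x) (m≡m%n+[m/n]*n a (ord x)) ⟩
    pow x (a % ord x + a / ord x * ord x)          ≡⟨ pow-+ x (a % ord x) (a / ord x * ord x) ⟩
    pow x (a % ord x) ∙ pow x (a / ord x * ord x)  ≡⟨ cong (pow x (a % ord x) ∙_) (pow-*ord x (a / ord x)) ⟩
    pow x (a % ord x) ∙ e                          ≡⟨ identityʳ _ ⟩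
    pow x (a % ord x)                              ∎

  pow≡pow⇒%ord≡ : ∀ x a b → pow x a ≡ pow x b → a % ord x ≡ b % ord x
  pow≡pow⇒%ord≡ x a b xᵃ≡xᵇ = pow-injective-below-ord x (m%n<n a (ord x)) (m%n<n b (ord x))
    (trans (sym (pow-%ord x a)) (trans xᵃ≡xᵇ (pow-%ord x b)))

  pow≡e⇒ord∣ : ∀ x {a} → pow x a ≡ e → ord x ∣ a
  pow≡e⇒ord∣ x {a} xᵃ≡e = m%n≡0⇒n∣m a (ord x) (pow≡pow⇒%ord≡ x a 0 xᵃ≡e)

  ord∣⇒pow≡e : ∀ x {a} → ord x ∣ a → pow x a ≡ e
  ord∣⇒pow≡e x (divides q refl) = pow-*ord x q

  -- Lagrange: the cosets a ∙ ⟨x⟩ partition any finite set closed under (_∙ x).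

  module Cosets (x : Carrier) where

    _∙x^_ : Carrier → ℕ → Carrier
    a ∙x^ i = a ∙ pow x i

    coset : Carrier → List Carrier
    coset a = applyUpTo (a ∙x^_) (ord x)

    coset-unique : ∀ a → Unique (coset a)
    coset-unique a = applyUpTo⁺₁ (a ∙x^_) (ord x) (λ i<j j<o → pow-distinct-below-ord x i<j j<o ∘ ∙-cancelˡ a _ _)

    coset-⊆ : ∀ {L} → (∀ {b} → b ∈ L → b ∙ x ∈ L) → ∀ {a} → a ∈ L → ∀ i → a ∙ pow x i ∈ L
    coset-⊆ {L} closed a∈L zero    = subst (_∈ L) (sym (identityʳ _)) a∈L
    coset-⊆ {L} closed {a} a∈L (suc i) =
      subst (_∈ L) (trans (assoc a (pow x i) x) (cong (a ∙_) (sym (pow-suc-∙ʳ x i)))) (closed (coset-⊆ closed a∈L i))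

    ∙x∈coset⇒∈coset : ∀ a b → b ∙ x ∈ coset a → b ∈ coset a
    ∙x∈coset⇒∈coset a b bx∈ with ∈-applyUpTo⁻ (a ∙x^_) bx∈
    ... | i , i<o , bx≡axⁱ = subst (_∈ coset a) (sym b≡a∙x^previous) (∈-applyUpTo⁺ (a ∙x^_) (previous<o i i<o))
      where
      previous : ℕ → ℕ
      previous zero    = pred (ord x)
      previous (suc i) = i
      previous<o : ∀ i → i < ord x → previous i < ord x
      previous<o zero    _     = n<1+n _
      previous<o (suc i) i+1<o = <⇒≤ i+1<o
      a∙xⁱ≡a∙x^previous∙x : ∀ i → a ∙ pow x i ≡ a ∙ pow x (previous i) ∙ x
      a∙xⁱ≡a∙x^previous∙x zero    =
        trans (cong (a ∙_) (trans (sym (pow-ord x)) (pow-suc-∙ʳ x (pred (ord x))))) (sym (assoc a _ x))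
      a∙xⁱ≡a∙x^previous∙x (suc i) = trans (cong (a ∙_) (pow-suc-∙ʳ x i)) (sym (assoc a _ x))
      b≡a∙x^previous : b ≡ a ∙ pow x (previous i)
      b≡a∙x^previous = ∙-cancelʳ x _ _ (trans bx≡axⁱ (a∙xⁱ≡a∙x^previous∙x i))

    ClosedUnder-x : List Carrier → Set
    ClosedUnder-x L = ∀ {b} → b ∈ L → b ∙ x ∈ L

    coset∩-length : ∀ {L} → Unique L → ClosedUnder-x L → ∀ {a} → a ∈ L → length (filter (_∈? coset a) L) ≡ ord x
    coset∩-length {L} L! closed {a} a∈L = trans
      (⊆∧⊇⇒length≡ (filter⁺ (_∈? coset a) L!) (coset-unique a)
        (λ z∈ → proj₂ (∈-filter⁻ (_∈? coset a) {xs = L} z∈))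
        (λ z∈ → ∈-filter⁺ (_∈? coset a) (coset-member∈L z∈) z∈))
      (length-applyUpTo (a ∙x^_) (ord x))
      where
      coset-member∈L : ∀ {z} → z ∈ coset a → z ∈ L
      coset-member∈L z∈ with ∈-applyUpTo⁻ (a ∙x^_) z∈
      ... | i , _ , refl = coset-⊆ closed a∈L i

    closed-∖coset : ∀ {L} → ClosedUnder-x L → ∀ a → ClosedUnder-x (filter (∁? (_∈? coset a)) L)
    closed-∖coset {L} closed a b∈ with ∈-filter⁻ (∁? (_∈? coset a)) {xs = L} b∈
    ... | b∈L , b∉coset = ∈-filter⁺ (∁? (_∈? coset a)) (closed b∈L) (b∉coset ∘ ∙x∈coset⇒∈coset a _)

    ord∣length : ∀ N (L : List Carrier) → length L ≤ N → Unique L → ClosedUnder-x L → ord x ∣ length L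
    ord∣length N       []      _     _  _      = divides 0 refl
    ord∣length zero    (a ∷ L) ()    _  _
    ord∣length (suc N) (a ∷ L) |L|≤N L! closed =
      subst (ord x ∣_) (sym split) (∣m∣n⇒∣m+n (∣-reflexive (sym |coset|≡ord))
        (ord∣length N rest |rest|≤N (filter⁺ (∁? (_∈? coset a)) L!) (closed-∖coset closed a)))
      where
      rest : List Carrier
      rest = filter (∁? (_∈? coset a)) (a ∷ L)
      split : length (a ∷ L) ≡ length (filter (_∈? coset a) (a ∷ L)) + length rest
      split = length-filter-∁ (_∈? coset a) (a ∷ L)
      |coset|≡ord : length (filter (_∈? coset a) (a ∷ L)) ≡ ord x
      |coset|≡ord = coset∩-length L! closed (here refl)
      |rest|≤N : length rest ≤ N
      |rest|≤N = ≤-trans (m≤n+m (length rest) (pred (ord x)))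
                   (≤-pred (subst (_≤ suc N) (trans split (cong (_+ length rest) |coset|≡ord)) |L|≤N))

  pow-card≡e : ∀ {K N} → Card K N → (∀ {a b} → K a → K b → K (a ∙ b)) → ∀ {x} → K x → pow x N ≡ e
  pow-card≡e {K} {N} c closed {x} x∈K with card⇒listing c
  ... | L , (L! , K⊆L , L⊆K) , refl =
    ord∣⇒pow≡e x (Cosets.ord∣length x (length L) L ≤-refl L! (λ b∈ → K⊆L (closed (L⊆K b∈) x∈K)))

  cyc⇒pow : ∀ {x z} → cyc x z → ∃ λ k → z ≡ pow x k
  cyc⇒pow {x} (gen refl) = 1 , sym (pow-1 x)
  cyc⇒pow     one        = 0 , refl
  cyc⇒pow {x} (mul p q) with cyc⇒pow p | cyc⇒pow q
  ... | a , refl | b , refl = a + b , sym (pow-+ x a b)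
  cyc⇒pow {x} (inv p) with cyc⇒pow p
  ... | a , refl = a * pred (ord x) , (begin
    pow x a ⁻¹                   ≡⟨ sym (pow-⁻¹ x a) ⟩
    pow (x ⁻¹) a                 ≡⟨ cong (λ z → pow z a) (pow-pred-ord x) ⟩
    pow (pow x (pred (ord x))) a ≡⟨ sym (pow-*-comm x a (pred (ord x))) ⟩
    pow x (a * pred (ord x))     ∎)

  card-cyc≡ord : ∀ {x m} → Card (cyc x) m → m ≡ ord x
  card-cyc≡ord {x} c = trans (card≡length c (powers! , cyc⊆powers , powers⊆cyc)) (length-applyUpTo (pow x) (ord x))
    where
    powers : List Carrier
    powers = applyUpTo (pow x) (ord x)
    powers! : Unique powers
    powers! = applyUpTo⁺₁ (pow x) (ord x) (pow-distinct-below-ord x)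
    cyc⊆powers : ∀ {z} → cyc x z → z ∈ powers
    cyc⊆powers z∈⟨x⟩ with cyc⇒pow z∈⟨x⟩
    ... | k , refl = subst (_∈ powers) (sym (pow-%ord x k)) (∈-applyUpTo⁺ (pow x) (m%n<n k (ord x)))
    powers⊆cyc : ∀ {z} → z ∈ powers → cyc x z
    powers⊆cyc z∈ with ∈-applyUpTo⁻ (pow x) z∈
    ... | k , _ , refl = pow∈cyc x k

  pow⇒PosPow : ∀ {z w} J → pow z J ≡ w → PosPow z w
  pow⇒PosPow {z} {w} J zᴶ≡w = J + pred (ord z) , sym (begin
    pow z (suc (J + pred (ord z))) ≡⟨ cong (pow z) (sym (+-suc J (pred (ord z)))) ⟩
    pow z (J + ord z)              ≡⟨ pow-+ z J (ord z) ⟩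
    pow z J ∙ pow z (ord z)        ≡⟨ cong₂ _∙_ zᴶ≡w (pow-ord z) ⟩
    w ∙ e                          ≡⟨ identityʳ w ⟩
    w                              ∎)

module CoprimeDecomposition (G : Grp) (n : ℕ) (card : GroupNotions.Card G (λ _ → ⊤) n)
                            (nilpotent : GroupNotions.Nilpotent G) where

  open GroupLaws G
  open GroupProducts G
  open CoprimeExponents G
  open NilpotentGroups G using (coprime-orders-commute)
  open FiniteGroup G n card
  open Arithmetic
  open MixedRadix
  open UniqueLists
  open import Data.Nat.Coprimality using (Coprime)
  open import Data.Nat.Divisibility using (_∣_; divides)
  open import Data.Nat.Properties using (≤-reflexive)
  open import Data.Fin.Properties using (suc-injective)
  open import Data.List using (List; tabulate)
  open import Data.List.Properties using (length-tabulate)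
  open import Data.List.Membership.Propositional using (_∈_)
  open import Data.List.Membership.Propositional.Properties using (∈-tabulate⁻)
  open import Data.List.Relation.Unary.Unique.Propositional.Properties using (tabulate⁺)

  record CoprimeFamily (r : ℕ) : Set₁ where
    field
      member            : Fin r → Pred
      exponent          : Fin r → ℕ
      pow-exponent      : ∀ i {c} → member i c → pow c (exponent i) ≡ e
      exponents-coprime : ∀ i j → i ≢ j → Coprime (exponent i) (exponent j)

    Components : (Fin r → Carrier) → Set
    Components c = ∀ i → member i (c i)

    components-commute : ∀ {c} → Components c → ∀ i j → i ≢ j → Commute (c i) (c j)
    components-commute c∈ i j i≢j =
      coprime-orders-commute nilpotent (exponents-coprime i j i≢j) (pow-exponent i (c∈ i)) (pow-exponent j (c∈ j))

    pow-prod-exponents : ∀ {c} → Components c → pow (prod c) (prodℕ exponent) ≡ e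
    pow-prod-exponents {c} c∈ =
      trans (pow-prod c (components-commute c∈) (prodℕ exponent)) (prod-e _ λ i → pow-component i (∣-prodℕ exponent i))
      where
      pow-component : ∀ i → exponent i ∣ prodℕ exponent → pow (c i) (prodℕ exponent) ≡ e
      pow-component i (divides q eq) = trans (cong (pow (c i)) eq) (pow-*≡e (pow-exponent i (c∈ i)) q)

  tail : ∀ {r} → CoprimeFamily (suc r) → CoprimeFamily r
  tail F = record
    { member            = member ∘ fsuc
    ; exponent          = exponent ∘ fsuc
    ; pow-exponent      = pow-exponent ∘ fsuc
    ; exponents-coprime = λ i j i≢j → exponents-coprime (fsuc i) (fsuc j) (i≢j ∘ suc-injective)
    }
    where open CoprimeFamily F

  -- Raising to the product of the other exponents kills every component but the first,
  -- and is injective on the first.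
  prod-injective : ∀ {r} (F : CoprimeFamily r) {c c'} → CoprimeFamily.Components F c → CoprimeFamily.Components F c' →
                   prod c ≡ prod c' → ∀ i → c i ≡ c' i
  prod-injective {suc r} F {c} {c'} c∈ c'∈ prod≡ = same
    where
    open CoprimeFamily F
    E : ℕ
    E = prodℕ (exponent ∘ fsuc)
    pow-E : ∀ {d} → Components d → pow (prod d) E ≡ pow (d fzero) E
    pow-E {d} d∈ = trans (pow-∙ (commute-prod (d fzero) (d ∘ fsuc) (λ i → components-commute d∈ fzero (fsuc i) λ ())) E)
                     (trans (cong (pow (d fzero) E ∙_) (CoprimeFamily.pow-prod-exponents (tail F) (d∈ ∘ fsuc)))
                            (identityʳ _))
    same-head : c fzero ≡ c' fzero
    same-head = pow-injective-coprime (coprime-prodℕʳ (exponent ∘ fsuc) (λ j → exponents-coprime fzero (fsuc j) λ ()))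
      (pow-exponent fzero (c∈ fzero)) (pow-exponent fzero (c'∈ fzero))
      (trans (sym (pow-E c∈)) (trans (cong (λ z → pow z E) prod≡) (pow-E c'∈)))
    same : ∀ i → c i ≡ c' i
    same fzero    = same-head
    same (fsuc i) = prod-injective (tail F) (c∈ ∘ fsuc) (c'∈ ∘ fsuc)
      (∙-cancelˡ (c fzero) _ _ (trans prod≡ (cong (_∙ prod (c' ∘ fsuc)) (sym same-head)))) i

  -- The n products of components are distinct, so they exhaust the n elements of G.
  prod-surjective : ∀ {r} (F : CoprimeFamily r) → (∀ i → Card (CoprimeFamily.member F i) (CoprimeFamily.exponent F i)) →
                    prodℕ (CoprimeFamily.exponent F) ≡ n → ∀ z → ∃ λ c → CoprimeFamily.Components F c × z ≡ prod c
  prod-surjective {r} F cards ∏exponent≡n z with card⇒listing card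
  ... | elements , (elements! , all∈ , _) , |elements|≡n =
    component-tuple a , (λ i → member-enum i _) , z≡prod
    where
    open CoprimeFamily F
    enum : ∀ i → Fin (exponent i) → Carrier
    enum i = proj₁ (cards i)
    member-enum : ∀ i k → member i (enum i k)
    member-enum i = proj₁ (proj₂ (proj₂ (cards i)))
    component-tuple : Fin (prodℕ exponent) → Fin r → Carrier
    component-tuple a i = enum i (digits exponent a i)
    product : Fin (prodℕ exponent) → Carrier
    product = prod ∘ component-tuple
    product-injective : ∀ {a b} → product a ≡ product b → a ≡ b
    product-injective {a} {b} eq = digits-injective exponent λ i →
      card-injective (cards i) (prod-injective F (λ i → member-enum i _) (λ i → member-enum i _) eq i)
    products : List Carrier
    products = tabulate product
    z∈products : z ∈ products
    z∈products = ⊆∧length≥⇒⊇ _≟_ (tabulate⁺ product-injective) elements! (λ _ → all∈ tt)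
      (≤-reflexive (trans |elements|≡n (trans (sym ∏exponent≡n) (sym (length-tabulate product))))) (all∈ tt)
    a : Fin (prodℕ exponent)
    a = proj₁ (∈-tabulate⁻ z∈products)
    z≡prod : z ≡ prod (component-tuple a)
    z≡prod = proj₂ (∈-tabulate⁻ z∈products)

module SylowSplitting
  (G : Grp) (n r : ℕ) (p α : Fin r → ℕ)
  (p-prime : ∀ i → Prime (p i))
  (p-increasing : ∀ i j → toℕ i < toℕ j → p i < p j)
  (card : GroupNotions.Card G (λ _ → ⊤) n)
  (n≡∏ : n ≡ prodℕ (λ i → p i ^ α i))
  (nilpotent : GroupNotions.Nilpotent G)
  (P : Fin r → GroupNotions.Pred G)
  (P-sylow : ∀ i → GroupNotions.IsSubgroup G (P i) × GroupNotions.Card G (P i) (p i ^ α i))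
  (T : Subset r) where

  open import Data.Nat using (_%_; NonZero)
  open import Data.Fin.Subset using (_∈_; _∉_)
  open GroupLaws G
  open GroupProducts G
  open CoprimeExponents G
  open FiniteGroup G n card
  open CoprimeDecomposition G n card nilpotent
  open NilpotentGroups G using (coprime-orders-commute)
  open Arithmetic
  open UniqueLists
  open import Data.Bool using (if_then_else_)
  open import Data.Nat.Coprimality using (Coprime; coprime?; 1-coprimeTo)
  import Data.Nat.Coprimality as Coprime
  open import Data.Nat.Divisibility using (_∣_; divides)
  open import Data.Nat.DivMod using (m%n<n)
  open import Data.Nat.Properties using () renaming (_≟_ to _≟ℕ_)
  open import Data.Product.Properties using (,-injective)
  open import Data.Nat.Properties using (suc-injective; <-cmp; <⇒≢; *-identityʳ; *-identityˡ; *-comm; *-assoc)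
  open import Data.Fin.Properties using (toℕ-injective)
  open import Data.Fin.Subset.Properties using (_∈?_)
  open import Data.List using (List; length; filter; map; upTo; cartesianProduct)
  open import Data.List.Properties using (length-map)
  import Data.List.Membership.Propositional as List
  open import Data.List.Membership.Propositional.Properties
    using (∈-filter⁺; ∈-filter⁻; ∈-map⁺; ∈-map⁻; ∈-cartesianProduct⁺; ∈-cartesianProduct⁻; ∈-upTo⁺; ∈-upTo⁻)
  open import Data.List.Relation.Unary.Unique.Propositional using (Unique)
  open import Data.List.Relation.Unary.Unique.Propositional.Properties using (filter⁺; cartesianProduct⁺; upTo⁺)
  open import Relation.Nullary using (does; ¬?)
  open import Relation.Nullary.Decidable using (_×-dec_; _⊎-dec_)
  open import Relation.Binary.Definitions using (tri<; tri≈; tri>)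
  open ≡-Reasoning

  q : Fin r → ℕ
  q i = p i ^ α i

  P-∙ : ∀ i {a b} → P i a → P i b → P i (a ∙ b)
  P-∙ i = proj₁ (proj₂ (proj₁ (P-sylow i)))

  P-pow : ∀ i {a} → P i a → ∀ k → P i (pow a k)
  P-pow i a∈P zero    = proj₁ (proj₁ (P-sylow i))
  P-pow i a∈P (suc k) = P-∙ i a∈P (P-pow i a∈P k)

  q-coprime : ∀ i j → i ≢ j → Coprime (q i) (q j)
  q-coprime i j i≢j = distinct-prime-powers-coprime (p-prime i) (p-prime j) pᵢ≢pⱼ (α i) (α j)
    where
    pᵢ≢pⱼ : p i ≢ p j
    pᵢ≢pⱼ with <-cmp (toℕ i) (toℕ j)
    ... | tri< i<j _ _ = <⇒≢ (p-increasing i j i<j)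
    ... | tri≈ _ i≡j _ = ⊥-elim (i≢j (toℕ-injective i≡j))
    ... | tri> _ _ j<i = <⇒≢ (p-increasing j i j<i) ∘ sym

  sylow : CoprimeFamily r
  sylow = record
    { member            = P
    ; exponent          = q
    ; pow-exponent      = λ i → pow-card≡e (proj₂ (P-sylow i)) (P-∙ i)
    ; exponents-coprime = q-coprime
    }

  qᵀ qᶜ : Fin r → ℕ
  qᵀ i = if does (i ∈? T) then q i else 1
  qᶜ i = if does (i ∈? T) then 1 else q i

  M M' : ℕ
  M  = prodℕ qᵀ
  M' = prodℕ qᶜ

  n≡M*M' : n ≡ M * M'
  n≡M*M' = trans n≡∏ (trans (prodℕ-cong q≡qᵀ*qᶜ) (prodℕ-* qᵀ qᶜ))
    where
    q≡qᵀ*qᶜ : ∀ i → q i ≡ qᵀ i * qᶜ i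
    q≡qᵀ*qᶜ i with i ∈? T
    ... | yes _ = sym (*-identityʳ (q i))
    ... | no  _ = sym (*-identityˡ (q i))

  M⊥M' : Coprime M M'
  M⊥M' = coprime-prodℕʳ qᶜ λ j → Coprime.sym (coprime-prodℕʳ qᵀ λ i → Coprime.sym (qᵀ⊥qᶜ i j))
    where
    qᵀ⊥qᶜ : ∀ i j → Coprime (qᵀ i) (qᶜ j)
    qᵀ⊥qᶜ i j with i ∈? T | j ∈? T
    ... | no  _   | _      = 1-coprimeTo _
    ... | yes _   | yes _  = coprime-1ʳ (q i)
    ... | yes i∈T | no j∉T = q-coprime i j λ { refl → j∉T i∈T }

  q∣M : ∀ {i} → i ∈ T → q i ∣ M
  q∣M {i} i∈T = subst (_∣ M) qᵀᵢ≡qᵢ (∣-prodℕ qᵀ i)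
    where
    qᵀᵢ≡qᵢ : qᵀ i ≡ q i
    qᵀᵢ≡qᵢ with i ∈? T
    ... | yes _   = refl
    ... | no  i∉T = ⊥-elim (i∉T i∈T)

  q⊥M : ∀ {i} → i ∉ T → Coprime (q i) M
  q⊥M {i} i∉T = coprime-prodℕʳ qᵀ qᵢ⊥qᵀ
    where
    qᵢ⊥qᵀ : ∀ j → Coprime (q i) (qᵀ j)
    qᵢ⊥qᵀ j with j ∈? T
    ... | no  _   = coprime-1ʳ (q i)
    ... | yes j∈T = q-coprime i j λ { refl → i∉T j∈T }

  pow-n : ∀ z → pow z n ≡ e
  pow-n z = pow-card≡e card (λ _ _ → tt) tt

  H : Pred
  H = ProdSub P T

  support⇒pow-M : ∀ {x} → Support P x T → pow x M ≡ e
  support⇒pow-M (c , c∈P , refl , c-support) =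
    trans (pow-prod c (CoprimeFamily.components-commute sylow c∈P) M) (prod-e _ pow-component)
    where
    pow-component : ∀ i → pow (c i) M ≡ e
    pow-component i with i ∈? T
    ... | yes i∈T = let (divides k M≡kq) = q∣M i∈T in
                    trans (cong (pow (c i)) M≡kq) (pow-*≡e (CoprimeFamily.pow-exponent sylow i (c∈P i)) k)
    ... | no  i∉T = trans (cong (λ z → pow z M) (proj₂ (c-support i) i∉T)) (pow-e M)

  pow-M⇒∈H : ∀ {w} → pow w M ≡ e → H w
  pow-M⇒∈H {w} wᴹ≡e with prod-surjective sylow (proj₂ ∘ P-sylow) (sym n≡∏) w
  ... | c , c∈P , refl = prod∈⟨⟩ _ c c-in-T
    where
    cᴹ≡e : ∀ i → pow (c i) M ≡ e
    cᴹ≡e = prod-injective sylow (λ i → P-pow i (c∈P i) M) (λ i → proj₁ (proj₁ (P-sylow i)))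
      (trans (sym (pow-prod c (CoprimeFamily.components-commute sylow c∈P) M))
             (trans wᴹ≡e (sym (prod-e {r} (λ _ → e) λ _ → refl))))
    c-in-T : ∀ i → c i ≡ e ⊎ (∃ λ j → j ∈ T × P j (c i))
    c-in-T i with i ∈? T
    ... | yes i∈T = inj₂ (i , i∈T , c∈P i)
    ... | no  i∉T = inj₁ (pow-injective-coprime (q⊥M i∉T)
                      (CoprimeFamily.pow-exponent sylow i (c∈P i)) (pow-e (q i)) (trans (cᴹ≡e i) (sym (pow-e M))))

  K : Pred
  K t = pow t M' ≡ e

  K? : ∀ t → Dec (K t)
  K? t = pow t M' ≟ e

  e∈K : K e
  e∈K = pow-e M'

  commute-M-K : ∀ {w t} → pow w M ≡ e → K t → Commute w t
  commute-M-K = coprime-orders-commute nilpotent M⊥M'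

  split-unique : ∀ {w w' t t'} → pow w M ≡ e → pow w' M ≡ e → K t → K t' → w ∙ t ≡ w' ∙ t' → w ≡ w' × t ≡ t'
  split-unique {w} {w'} {t} {t'} wᴹ≡e w'ᴹ≡e t∈K t'∈K wt≡w't' =
    w≡w' , ∙-cancelˡ w _ _ (trans wt≡w't' (cong (_∙ t') (sym w≡w')))
    where
    pow-M' : ∀ {v s} → pow v M ≡ e → K s → pow (v ∙ s) M' ≡ pow v M'
    pow-M' {v} vᴹ≡e s∈K = trans (pow-∙ (commute-M-K vᴹ≡e s∈K) M') (trans (cong (pow v M' ∙_) s∈K) (identityʳ _))
    w≡w' : w ≡ w'
    w≡w' = pow-injective-coprime M⊥M' wᴹ≡e w'ᴹ≡e
      (trans (sym (pow-M' wᴹ≡e t∈K)) (trans (cong (λ z → pow z M') wt≡w't') (pow-M' w'ᴹ≡e t'∈K)))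

  -- w is the power of z with w ^ M' = z ^ M', so that t = w⁻¹ ∙ z is killed by M'.
  split : ∀ z → ∃₂ λ w t → pow w M ≡ e × K t × z ≡ w ∙ t
  split z with coprime⇒pow-invertible (Coprime.sym M⊥M')
  ... | J , invert = w , w ⁻¹ ∙ z , wᴹ≡e , t∈K , z≡w∙t
    where
    a : Carrier
    a = pow z M'
    aᴹ≡e : pow a M ≡ e
    aᴹ≡e = trans (sym (pow-* z M' M)) (trans (cong (pow z) (trans (*-comm M' M) (sym n≡M*M'))) (pow-n z))
    w : Carrier
    w = pow a J
    wᴹ≡e : pow w M ≡ e
    wᴹ≡e = pow-pow≡e {a} {M} aᴹ≡e J
    wᴹ'≡a : pow w M' ≡ a
    wᴹ'≡a = trans (sym (pow-* a J M')) (trans (pow-*-comm a J M') (invert a aᴹ≡e))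
    w↔z : Commute (w ⁻¹) z
    w↔z = commute-⁻¹ (subst (λ v → Commute v z) (pow-*-comm z J M') (sym (commute-pow refl (J * M'))))
    t∈K : K (w ⁻¹ ∙ z)
    t∈K = begin
      pow (w ⁻¹ ∙ z) M'         ≡⟨ pow-∙ w↔z M' ⟩
      pow (w ⁻¹) M' ∙ pow z M'  ≡⟨ cong (_∙ a) (trans (pow-⁻¹ w M') (cong _⁻¹ wᴹ'≡a)) ⟩
      a ⁻¹ ∙ a                  ≡⟨ inverseˡ a ⟩
      e                         ∎
    z≡w∙t : z ≡ w ∙ (w ⁻¹ ∙ z)
    z≡w∙t = sym (trans (sym (assoc w (w ⁻¹) z)) (trans (cong (_∙ z) (inverseʳ w)) (identityˡ z)))

  -- Neighbours of an element of order o correspond to pairs (k , t), k < o, t ∈ K, satisfying: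
  NeighbourIndex : (o : ℕ) .{{_ : NonZero o}} → ℕ × Carrier → Set
  NeighbourIndex o (k , t) = ¬ (k ≡ 1 % o × t ≡ e) × (t ≡ e ⊎ Coprime k o)

  neighbourIndex? : (o : ℕ) .{{_ : NonZero o}} → ∀ kt → Dec (NeighbourIndex o kt)
  neighbourIndex? o (k , t) = ¬? ((k ≟ℕ 1 % o) ×-dec (t ≟ e)) ×-dec ((t ≟ e) ⊎-dec coprime? k o)

  elements : List Carrier
  elements = proj₁ (card⇒listing card)

  elements-listing : IsListing (λ _ → ⊤) elements
  elements-listing = proj₁ (proj₂ (card⇒listing card))

  K-elements : List Carrier
  K-elements = filter K? elements

  neighbourIndices : (o : ℕ) .{{_ : NonZero o}} → List (ℕ × Carrier)
  neighbourIndices o = filter (neighbourIndex? o) (cartesianProduct (upTo o) K-elements)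

  module Neighbours (x : Carrier) (xᴹ≡e : pow x M ≡ e) (x-max : MaxCyclicIn x H) where

    o : ℕ
    o = ord x

    Φ : ℕ × Carrier → Carrier
    Φ (k , t) = pow x k ∙ t

    Φ-injective : ∀ {k k' t t'} → k < o → k' < o → K t → K t' → Φ (k , t) ≡ Φ (k' , t') → (k , t) ≡ (k' , t')
    Φ-injective {k} {k'} k<o k'<o t∈K t'∈K Φ≡
      with split-unique (pow-pow≡e {x} {M} xᴹ≡e k) (pow-pow≡e {x} {M} xᴹ≡e k') t∈K t'∈K Φ≡
    ... | xᵏ≡xᵏ' , refl = cong (_, _) (pow-injective-below-ord x k<o k'<o xᵏ≡xᵏ')

    pow≡Φ : ∀ j → pow x j ≡ Φ (j % o , e)
    pow≡Φ j = trans (pow-%ord x j) (sym (identityʳ _))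

    x≡Φ : x ≡ Φ (1 % o , e)
    x≡Φ = trans (sym (pow-1 x)) (pow≡Φ 1)

    power-of-x⇒t≡e : ∀ {k t} → k < o → K t → PosPow x (Φ (k , t)) → t ≡ e
    power-of-x⇒t≡e k<o t∈K (j , Φ≡xʲ⁺¹) =
      cong proj₂ (Φ-injective k<o (m%n<n (suc j) o) t∈K e∈K (trans Φ≡xʲ⁺¹ (pow≡Φ (suc j))))

    t≡e⇒power-of-x : ∀ {k t} → t ≡ e → PosPow x (Φ (k , t))
    t≡e⇒power-of-x {k} refl = pow⇒PosPow k (sym (identityʳ (pow x k)))

    coprime⇒x-power-of : ∀ {k t} → K t → Coprime k o → PosPow (Φ (k , t)) x
    coprime⇒x-power-of {k} {t} t∈K k⊥o
      with coprime⇒pow-invertible (Coprime.sym (coprime-*ʳ (Coprime.sym k⊥o) (coprime-∣ˡ M⊥M' (pow≡e⇒ord∣ x xᴹ≡e))))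
    ... | J , invert = pow⇒PosPow (M' * J) (begin
      pow (pow x k ∙ t) (M' * J)                ≡⟨ pow-∙ (commute-M-K (pow-pow≡e {x} {M} xᴹ≡e k) t∈K) (M' * J) ⟩
      pow (pow x k) (M' * J) ∙ pow t (M' * J)   ≡⟨ cong₂ _∙_ (sym (pow-* x k (M' * J))) tᴹ'ᴶ≡e ⟩
      pow x (k * (M' * J)) ∙ e                  ≡⟨ identityʳ _ ⟩
      pow x (k * (M' * J))                      ≡⟨ cong (pow x) (sym (*-assoc k M' J)) ⟩
      pow x (k * M' * J)                        ≡⟨ pow-* x (k * M') J ⟩
      pow (pow x (k * M')) J                    ≡⟨ invert x (pow-ord x) ⟩
      x                                         ∎)
      where
      tᴹ'ᴶ≡e : pow t (M' * J) ≡ e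
      tᴹ'ᴶ≡e = trans (pow-* t M' J) (trans (cong (λ z → pow z J) t∈K) (pow-e J))

    x-power-of⇒coprime : ∀ {k t} → K t → PosPow (Φ (k , t)) x → Coprime k o
    x-power-of⇒coprime {k} {t} t∈K (j , x≡Φʲ⁺¹) = *≡1-mod⇒coprime k (suc j) o (sym (pow≡pow⇒%ord≡ x 1 (k * suc j) x≡xᵏʲ))
      where
      x∙e≡ : x ∙ e ≡ pow x (k * suc j) ∙ pow t (suc j)
      x∙e≡ = trans (identityʳ x) (trans x≡Φʲ⁺¹ (trans (pow-∙ (commute-M-K (pow-pow≡e {x} {M} xᴹ≡e k) t∈K) (suc j))
                                                        (cong (_∙ pow t (suc j)) (sym (pow-* x k (suc j))))))
      x≡xᵏʲ : pow x 1 ≡ pow x (k * suc j)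
      x≡xᵏʲ = trans (pow-1 x) (proj₁ (split-unique xᴹ≡e (pow-pow≡e {x} {M} xᴹ≡e (k * suc j)) e∈K
                                                   (pow-pow≡e {t} {M'} t∈K (suc j)) x∙e≡))

    neighbour⇒index : ∀ {k t} → k < o → K t → Nbr x (Φ (k , t)) → NeighbourIndex o (k , t)
    neighbour⇒index {k} {t} k<o t∈K (Φ≢x , adjacent) = (λ { (refl , refl) → Φ≢x (sym x≡Φ) }) , which adjacent
      where
      which : PosPow x (Φ (k , t)) ⊎ PosPow (Φ (k , t)) x → t ≡ e ⊎ Coprime k o
      which (inj₁ Φ-power-of-x) = inj₁ (power-of-x⇒t≡e k<o t∈K Φ-power-of-x)
      which (inj₂ x-power-of-Φ) = inj₂ (x-power-of⇒coprime t∈K x-power-of-Φ)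

    index⇒neighbour : ∀ {k t} → k < o → K t → NeighbourIndex o (k , t) → Nbr x (Φ (k , t))
    index⇒neighbour {k} {t} k<o t∈K (not-x , adjacency) =
      (λ Φ≡x → not-x (,-injective (Φ-injective k<o (m%n<n 1 o) t∈K e∈K (trans Φ≡x x≡Φ)))) , which adjacency
      where
      which : t ≡ e ⊎ Coprime k o → PosPow x (Φ (k , t)) ⊎ PosPow (Φ (k , t)) x
      which (inj₁ t≡e) = inj₁ (t≡e⇒power-of-x {k} t≡e)
      which (inj₂ k⊥o) = inj₂ (coprime⇒x-power-of t∈K k⊥o)

    -- If x is a power of z = w ∙ t, it is the same power of w; maximality of ⟨x⟩ in H forces w ∈ ⟨x⟩.
    neighbour⇒Φ : ∀ {z} → Nbr x z → ∃ λ kt → proj₁ kt < o × K (proj₂ kt) × z ≡ Φ kt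
    neighbour⇒Φ (_ , inj₁ (j , z≡xʲ⁺¹)) = (suc j % o , e) , m%n<n (suc j) o , e∈K , trans z≡xʲ⁺¹ (pow≡Φ (suc j))
    neighbour⇒Φ {z} (_ , inj₂ (j , x≡zʲ⁺¹)) with split z
    ... | w , t , wᴹ≡e , t∈K , refl with cyc⇒pow w∈⟨x⟩
      where
      x≡wʲ⁺¹ : x ≡ pow w (suc j)
      x≡wʲ⁺¹ = proj₁ (split-unique xᴹ≡e (pow-pow≡e {w} {M} wᴹ≡e (suc j)) e∈K (pow-pow≡e {t} {M'} t∈K (suc j))
                 (trans (identityʳ x) (trans x≡zʲ⁺¹ (pow-∙ (commute-M-K wᴹ≡e t∈K) (suc j)))))
      w∈⟨x⟩ : cyc x w
      w∈⟨x⟩ = proj₂ x-max w (pow-M⇒∈H wᴹ≡e) (cyc-⊆ (subst (cyc w) (sym x≡wʲ⁺¹) (pow∈cyc w (suc j)))) (gen refl)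
    ... | k , refl = (k % o , t) , m%n<n k o , t∈K , cong (_∙ t) (pow-%ord x k)

    index∈⇒ : ∀ {kt} → kt List.∈ neighbourIndices o → proj₁ kt < o × K (proj₂ kt) × NeighbourIndex o kt
    index∈⇒ {k , t} kt∈ with ∈-filter⁻ (neighbourIndex? o) {xs = cartesianProduct (upTo o) K-elements} kt∈
    ... | kt∈pairs , index with ∈-cartesianProduct⁻ (upTo o) K-elements kt∈pairs
    ...   | k∈ , t∈ = ∈-upTo⁻ k∈ , proj₂ (∈-filter⁻ K? {xs = elements} t∈) , index

    neighbour-listing : IsListing (Nbr x) (map Φ (neighbourIndices o))
    neighbour-listing = unique , neighbour⇒∈ , ∈⇒neighbour
      where
      unique : Unique (map Φ (neighbourIndices o))
      unique = map⁺-injectiveOn Φ Φ-injectiveOn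
                 (filter⁺ (neighbourIndex? o) (cartesianProduct⁺ (upTo⁺ o) (filter⁺ K? (proj₁ elements-listing))))
        where
        Φ-injectiveOn : ∀ {a b} → a List.∈ neighbourIndices o → b List.∈ neighbourIndices o → Φ a ≡ Φ b → a ≡ b
        Φ-injectiveOn a∈ b∈ with index∈⇒ a∈ | index∈⇒ b∈
        ... | k<o , t∈K , _ | k'<o , t'∈K , _ = Φ-injective k<o k'<o t∈K t'∈K
      neighbour⇒∈ : ∀ {z} → Nbr x z → z List.∈ map Φ (neighbourIndices o)
      neighbour⇒∈ z~x with neighbour⇒Φ z~x
      ... | (k , t) , k<o , t∈K , refl = ∈-map⁺ Φ (∈-filter⁺ (neighbourIndex? o)
          (∈-cartesianProduct⁺ (∈-upTo⁺ k<o) (∈-filter⁺ K? (proj₁ (proj₂ elements-listing) tt) t∈K))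
          (neighbour⇒index k<o t∈K z~x))
      ∈⇒neighbour : ∀ {z} → z List.∈ map Φ (neighbourIndices o) → Nbr x z
      ∈⇒neighbour z∈ with ∈-map⁻ Φ z∈
      ... | kt , kt∈ , refl with index∈⇒ kt∈
      ...   | k<o , t∈K , index = index⇒neighbour k<o t∈K index

    has-neighbour : (∃ λ z → z ≢ e) → ∃ (Nbr x)
    has-neighbour (z₀ , z₀≢e) with x ≟ e
    ... | yes refl = z₀ , z₀≢e , inj₂ (pow⇒PosPow 0 refl)
    ... | no  x≢e  = e , x≢e ∘ sym , inj₁ (pow⇒PosPow 0 refl)

    degree : (∃ λ z → z ≢ e) → Deg x (length (neighbourIndices o))
    degree nontrivial =
      subst (Deg x) (length-map Φ (neighbourIndices o)) (listing⇒card neighbour-listing (has-neighbour nontrivial))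

  equal-order⇒equal-degree : ∀ {x y} → pow x M ≡ e → pow y M ≡ e → MaxCyclicIn x H → MaxCyclicIn y H →
                             (∃ λ z → z ≢ e) → ord x ≡ ord y → Σ ℕ λ d → Deg x d × Deg y d
  equal-order⇒equal-degree {x} {y} xᴹ≡e yᴹ≡e x-max y-max nontrivial ordx≡ordy =
    length (neighbourIndices (ord x)) ,
    Neighbours.degree x xᴹ≡e x-max nontrivial ,
    subst (λ o → Deg y (length (neighbourIndices (suc o)))) (suc-injective (sym ordx≡ordy))
      (Neighbours.degree y yᴹ≡e y-max nontrivial)

corollary2p3 : (G : Grp) → let open GroupNotions G in
    (n r : ℕ) → 2 ≤ r →
    (p α : Fin r → ℕ) →
    (∀ i → Prime (p i)) →
    (∀ i j → toℕ i < toℕ j → p i < p j) →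
    (∀ i → 1 ≤ α i) →
    Card (λ _ → ⊤) n →
    n ≡ prodℕ (λ i → p i ^ α i) →
    Nilpotent →
    (P : Fin r → Carrier → Set) →
    (∀ i → IsSubgroup (P i) × Card (P i) (p i ^ α i)) →
    (x y : Carrier) (T : Subset r) →
    Support P x T → Support P y T →
    MaxCyclicIn x (ProdSub P T) → MaxCyclicIn y (ProdSub P T) →
    (m : ℕ) → Card (cyc x) m → Card (cyc y) m →
    Σ ℕ λ d → Deg x d × Deg y d
corollary2p3 G n zero ()
corollary2p3 G n r@(suc _) _ p α p-prime p-increasing α≥1 card n≡∏ nilpotent P P-sylow
             x y T x-support y-support x-max y-max m |⟨x⟩|≡m |⟨y⟩|≡m =
  equal-order⇒equal-degree (support⇒pow-M x-support) (support⇒pow-M y-support) x-max y-max nontrivial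
    (trans (sym (card-cyc≡ord |⟨x⟩|≡m)) (card-cyc≡ord |⟨y⟩|≡m))
  where
  open SylowSplitting G n r p α p-prime p-increasing card n≡∏ nilpotent P P-sylow T
  open FiniteGroup G n card using (card-cyc≡ord; card≥2⇒nontrivial)
  open GroupNotions G using (e)
  open Arithmetic using (prime-power≥2)
  nontrivial : ∃ λ z → z ≢ e
  nontrivial = card≥2⇒nontrivial (proj₂ (P-sylow fzero)) (prime-power≥2 (p-prime fzero) (α≥1 fzero))
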